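{- For $n\ge1$ and distinct variables $v_1,\dots,v_n$, let $T_n$ be as defined in the context. Then: (1) $n(T_n)=3n-4$ for $n\ge2$; (2) $c(T_n)=8n-12$ for $n\ge2$; (3) $\ell(T_n)=24n-40$ for $n\ge2$; (4) $T_n$ is unsatisfiable and all its clauses have length at most $3$; (5) for $n\ge3$, $\mathrm{whd}(T_n)=\mathrm{wid}(T_n)=3$; (6) for $n\ge 2$ there exists a resolution refutation of $T_n$ using altogether $18n-29$ clauses.
   Context: Literals, clauses (finite sets of literals without complementary pairs), clause-sets; $n(F)=|\mathrm{var}(F)|$, $c(F)=|F|$, $\ell(F)=\sum_{C\in F}|C|$. Resolution: clauses $C,D$ with $C\cap\overline D=\{x\}$ (exactly one clashing literal) have resolvent $(C\cup D)\setminus\{x,\overline x\}$; a resolution refutation of $F$ is a resolution tree with leaves in $F$ deriving the empty clause $\bot$. For unsatisfiable $F$: $\mathrm{whd}(F)$ is the minimal $k$ such that $F$ has a resolution refutation where every resolution step has at least one parent of length $\le k$; $\mathrm{wid}(F)$ is the minimal $k$ such that $F$ has a resolution refutation all of whose clauses (axioms and resolvents) have length $\le k$. For an XOR-clause $C$ (a clause read as $\bigoplus_{x\in C}x=0$ over $\mathbb{Z}_2$), $X_0(C)$ is the set of all clauses $D$ with $\mathrm{var}(D)=\mathrm{var}(C)$ whose number of complemented literals has parity different from that of $C$. Let $C_1=\{v_1,\dots,v_n\}$ and $C_2=\{v_1,\dots,v_{n-1},\overline{v_n}\}$. $T_n:=X_1(\{C_1,C_2\})$, i.e. for $n\le2$,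 $T_n=X_0(C_1)\cup X_0(C_2)$, and for $n\ge3$, with new distinct variables $y_2,\dots,y_{n-1},y_2',\dots,y_{n-1}'$, $T_n$ is the union of $X_0(E)$ over the XOR-clauses $E$ in $\{v_1,v_2,y_2\}$, $\{y_{i-1},v_i,y_i\}$ ($3\le i\le n-1$), $\{y_{n-1},v_n\}$, $\{v_1,v_2,y_2'\}$, $\{y'_{i-1},v_i,y'_i\}$ ($3\le i\le n-1$), $\{y'_{n-1},\overline{v_n}\}$. -}

module Defs where

open import Data.Nat using (ℕ; zero; suc; _+_; _*_; _∸_; _≤_; _<_)
import Data.Nat as ℕ
open import Data.Bool using (Bool; true; false; not; _xor_)
import Data.Bool as 𝔹
open import Data.List using (List; []; _∷_; _++_; map; filter; length; concatMap; deduplicate; upTo)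
open import Data.Nat.ListAction using (sum)
open import Data.List.Relation.Unary.All using (All; all?)
open import Data.List.Relation.Unary.Any using (Any)
open import Data.List.Membership.Propositional using (_∈_)
import Data.List.Membership.DecPropositional as DecMem
open import Data.Product using (Σ; _×_; _,_; ∃)
open import Data.Sum using (_⊎_)
open import Data.Unit using (⊤)
open import Relation.Nullary using (¬_; Dec; yes; no; ¬?)
open import Relation.Nullary.Decidable using (_×-dec_)
open import Relation.Binary.PropositionalEquality using (_≡_; _≢_; refl; cong)
open import Relation.Binary.Definitions using (DecidableEquality)

Var : Set
Var = ℕ

data Lit : Set where
  pos : Var → Lit
  neg : Var → Lit

var : Lit → Var
var (pos x) = x
var (neg x) = x

compl : Lit → Lit
compl (pos x) = neg x
compl (neg x) = pos x

_≟L_ : DecidableEquality Lit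
pos x ≟L pos y with x ℕ.≟ y
... | yes refl = yes refl
... | no p = no λ { refl → p refl }
pos x ≟L neg y = no λ ()
neg x ≟L pos y = no λ ()
neg x ≟L neg y with x ℕ.≟ y
... | yes refl = yes refl
... | no p = no λ { refl → p refl }

-- A clause is a finite set of literals, represented by a list
-- (order and repetitions irrelevant); a clause-set is a finite set of
-- clauses, represented by a list of clauses.
Clause : Set
Clause = List Lit

ClauseSet : Set
ClauseSet = List Clause

open DecMem _≟L_ using (_∈?_)

_≐_ : Clause → Clause → Set
C ≐ D = All (_∈ D) C × All (_∈ C) D

_≐?_ : (C D : Clause) → Dec (C ≐ D)
C ≐? D = all? (_∈? D) C ×-dec all? (_∈? C) D

len : Clause → ℕ
len C = length (deduplicate _≟L_ C)

distinctClauses : ClauseSet → ClauseSet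
distinctClauses F = deduplicate _≐?_ F

nF : ClauseSet → ℕ
nF F = length (deduplicate ℕ._≟_ (concatMap (map var) F))

cF : ClauseSet → ℕ
cF F = length (distinctClauses F)

ℓF : ClauseSet → ℕ
ℓF F = sum (map len (distinctClauses F))

Assignment : Set
Assignment = Var → Bool

litVal : Assignment → Lit → Bool
litVal φ (pos x) = φ x
litVal φ (neg x) = not (φ x)

SatClause : Assignment → Clause → Set
SatClause φ C = Any (λ l → litVal φ l ≡ true) C

Satisfiable : ClauseSet → Set
Satisfiable F = ∃ λ (φ : Assignment) → All (SatClause φ) F

Unsatisfiable : ClauseSet → Set
Unsatisfiable F = ¬ Satisfiable F

Clash : Clause → Clause → Lit → Set
Clash C D x = (x ∈ C) × (compl x ∈ D) × (∀ y → y ∈ C → compl y ∈ D → y ≡ x)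

resolvent : Clause → Clause → Lit → Clause
resolvent C D x = filter (λ l → ¬? (l ≟L x) ×-dec ¬? (l ≟L compl x)) (C ++ D)

data Deriv (F : ClauseSet) : Clause → Set where
  axiom : ∀ {C} → C ∈ F → Deriv F C
  res   : ∀ {C D E} (x : Lit) → Deriv F C → Deriv F D →
          Clash C D x → E ≐ resolvent C D x → Deriv F E

Refutation : ClauseSet → Set
Refutation F = Deriv F []

labels : ∀ {F C} → Deriv F C → List Clause
labels (axiom {C} _) = C ∷ []
labels (res {E = E} _ t₁ t₂ _ _) = E ∷ (labels t₁ ++ labels t₂)

numClauses : ∀ {F C} → Deriv F C → ℕ
numClauses t = length (deduplicate _≐?_ (labels t))

HardnessBound : ℕ → ∀ {F C} → Deriv F C → Set
HardnessBound k (axiom _) = ⊤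
HardnessBound k (res {C} {D} _ t₁ t₂ _ _) =
  (len C ≤ k ⊎ len D ≤ k) × HardnessBound k t₁ × HardnessBound k t₂

WidthBound : ℕ → ∀ {F C} → Deriv F C → Set
WidthBound k t = All (λ C → len C ≤ k) (labels t)

HasWhd : ClauseSet → ℕ → Set
HasWhd F k = Σ (Refutation F) (HardnessBound k)

HasWid : ClauseSet → ℕ → Set
HasWid F k = Σ (Refutation F) (WidthBound k)

IsMinimal : (ℕ → Set) → ℕ → Set
IsMinimal P k = P k × (∀ j → j < k → ¬ P j)

WhdIs : ClauseSet → ℕ → Set
WhdIs F k = IsMinimal (HasWhd F) k

WidIs : ClauseSet → ℕ → Set
WidIs F k = IsMinimal (HasWid F) k

negParity : Clause → Bool
negParity [] = false
negParity (pos _ ∷ C) = negParity C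
negParity (neg _ ∷ C) = not (negParity C)

allSigns : List Var → List Clause
allSigns [] = [] ∷ []
allSigns (x ∷ xs) = map (pos x ∷_) (allSigns xs) ++ map (neg x ∷_) (allSigns xs)

X0 : Clause → ClauseSet
X0 C = filter (λ D → ¬? (negParity D 𝔹.≟ negParity C)) (allSigns (map var C))

data VName : Set where
  V  : ℕ → VName
  Y  : ℕ → VName
  Y' : ℕ → VName

Relevant : ℕ → VName → Set
Relevant n (V i)  = 1 ≤ i × i ≤ n
Relevant n (Y i)  = 2 ≤ i × i ≤ n ∸ 1 × 3 ≤ n
Relevant n (Y' i) = 2 ≤ i × i ≤ n ∸ 1 × 3 ≤ n

DistinctNames : ℕ → (VName → Var) → Set
DistinctNames n nm = ∀ a b → Relevant n a → Relevant n b → nm a ≡ nm b → a ≡ b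

TnXor : ℕ → (VName → Var) → List Clause
TnXor zero nm = []
TnXor (suc zero) nm =
  (pos (nm (V 1)) ∷ []) ∷ (neg (nm (V 1)) ∷ []) ∷ []
TnXor (suc (suc zero)) nm =
  (pos (nm (V 1)) ∷ pos (nm (V 2)) ∷ []) ∷
  (pos (nm (V 1)) ∷ neg (nm (V 2)) ∷ []) ∷ []
TnXor n@(suc (suc (suc _))) nm =
  (v 1 ∷ v 2 ∷ y 2 ∷ []) ∷
  map (λ i → y (i ∸ 1) ∷ v i ∷ y i ∷ []) mid ++
  ((y (n ∸ 1) ∷ v n ∷ []) ∷
  (v 1 ∷ v 2 ∷ y' 2 ∷ []) ∷
  map (λ i → y' (i ∸ 1) ∷ v i ∷ y' i ∷ []) mid ++
  ((y' (n ∸ 1) ∷ neg (nm (V n)) ∷ []) ∷ []))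
  where
  v y y' : ℕ → Lit
  v i = pos (nm (V i))
  y i = pos (nm (Y i))
  y' i = pos (nm (Y' i))
  -- indices 3 ≤ i ≤ n-1
  mid : List ℕ
  mid = map (3 +_) (upTo (n ∸ 3))

Tn : ℕ → (VName → Var) → ClauseSet
Tn n nm = concatMap X0 (TnXor n nm)

module Submission where

-- For n ≥ 3 the XOR-clauses of Tₙ form two
-- chains v₁ ⊕ v₂ ⊕ y₂, y_{i-1} ⊕ vᵢ ⊕ yᵢ, …, y_{n-1} ⊕ vₙ (and the primed
-- chain ending in v̄ₙ), so Tₙ is the union of renamed copies of three small
-- clause-sets ("gadgets"): a start over v₁ v₂ y₂ y'₂, one step per
-- 3 ≤ i ≤ n-1 over y_{i-1} y'_{i-1} vᵢ yᵢ y'ᵢ, and an end over y_{n-1} y'_{n-1} vₙ.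
-- The start derives y₂ = y'₂, each step propagates y_{i-1} = y'_{i-1} to
-- yᵢ = y'ᵢ, and the end refutes y_{n-1} = y'_{n-1}; these small derivations,
-- checked by evaluation, are transported along injective renamings and chained
-- into a refutation of width 3.  Counting (n, c, ℓ and the clauses of the
-- refutation) uses that copies for different steps are separated by the index
-- of the names they introduce, so no clause is counted twice.  The lower bound
-- 3 for hardness (hence width) is an invariant of hardness-2 derivations: every
-- derived clause is either over the three end variables and true under two
-- complementary assignments, or has three literals, two outside those
-- variables; the empty clause is neither.

open import Defs
open import Data.Nat using (ℕ; _+_; _*_; _∸_; _≤_)
open import Data.Product using (Σ; _×_)
open import Data.List.Relation.Unary.All using (All)
open import Relation.Binary.PropositionalEquality using (_≡_)
open import Level using (0ℓ)
open import Relation.Binary.Bundles using (DecSetoid)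

module Distinct (S : DecSetoid 0ℓ 0ℓ) where

  open import Data.Nat using (ℕ; suc; _+_; _≤_; s≤s; z≤n)
  open import Data.Nat.ListAction using (sum)
  open import Data.List using (List; []; _∷_; map; length; deduplicate)
  open import Data.List.Properties using (filter-all)
  open import Data.List.Relation.Unary.All using (All; []; _∷_)
  open import Data.List.Relation.Unary.Any using (here; there)
  open import Data.List.Relation.Unary.AllPairs using ([]; _∷_)
  open import Data.Empty using (⊥-elim)
  open import Function using (_∘_)
  open import Relation.Nullary using (¬_; ¬?)
  open import Relation.Binary.PropositionalEquality using (_≡_; refl; sym; cong; subst; module ≡-Reasoning)
  open import Data.Nat.Properties using (+-commutativeSemigroup)
  open import Algebra.Properties.CommutativeSemigroup +-commutativeSemigroup using (x∙yz≈y∙xz)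
  open import Data.List.Relation.Unary.Unique.DecSetoid.Properties using (deduplicate-!)
  import Data.List.Membership.Setoid.Properties as ∈ₚ

  open DecSetoid S renaming (Carrier to A; refl to ≈-refl; sym to ≈-sym; trans to ≈-trans)
  open import Data.List.Membership.Setoid setoid using (_∈_; _∉_)
  open import Data.List.Relation.Binary.Subset.Setoid setoid using (_⊆_)
  open import Data.List.Relation.Unary.Unique.Setoid setoid using (Unique)

  distinct : List A → List A
  distinct = deduplicate _≟_

  ⊆-distinct : ∀ {xs} → xs ⊆ distinct xs
  ⊆-distinct = ∈ₚ.∈-deduplicate⁺ setoid _≟_ (λ z≈y x≈y → ≈-trans x≈y (≈-sym z≈y))

  distinct-⊆ : ∀ {xs} → distinct xs ⊆ xs
  distinct-⊆ {xs} = ∈ₚ.∈-deduplicate⁻ setoid _≟_ xs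

  distinct-unique : ∀ xs → Unique (distinct xs)
  distinct-unique = deduplicate-! S

  distinct-of-unique : ∀ {xs} → Unique xs → distinct xs ≡ xs
  distinct-of-unique [] = refl
  distinct-of-unique {x ∷ xs} (x≉xs ∷ u) rewrite distinct-of-unique u =
    cong (x ∷_) (filter-all (¬? ∘ (x ≟_)) x≉xs)

  _without_ : ∀ {x} ys → x ∈ ys → List A
  (y ∷ ys) without here _ = ys
  (y ∷ ys) without there p = y ∷ (ys without p)

  Respects≈ : (A → ℕ) → Set
  Respects≈ f = ∀ {x y} → x ≈ y → f x ≡ f y

  Σ[_]_ : (A → ℕ) → List A → ℕ
  Σ[ f ] xs = sum (map f xs)

  module _ {f : A → ℕ} (f-resp : Respects≈ f) where

    sum-without : ∀ {x} ys (p : x ∈ ys) → Σ[ f ] ys ≡ f x + Σ[ f ] (ys without p)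
    sum-without (y ∷ ys) (here x≈y) = cong (_+ Σ[ f ] ys) (f-resp (≈-sym x≈y))
    sum-without {x} (y ∷ ys) (there p) = begin
      f y + Σ[ f ] ys                       ≡⟨ cong (f y +_) (sum-without ys p) ⟩
      f y + (f x + Σ[ f ] (ys without p))   ≡⟨ x∙yz≈y∙xz (f y) (f x) _ ⟩
      f x + (f y + Σ[ f ] (ys without p))   ∎
      where open ≡-Reasoning

  length-without : ∀ {x} ys (p : x ∈ ys) → length ys ≡ suc (length (ys without p))
  length-without (y ∷ ys) (here _) = refl
  length-without (y ∷ ys) (there p) = cong suc (length-without ys p)

  All-without : ∀ {P : A → Set} {x ys} (p : x ∈ ys) → All P ys → All P (ys without p)
  All-without (here _) (_ ∷ pys) = pys
  All-without (there p) (py ∷ pys) = py ∷ All-without p pys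

  without-unique : ∀ {x ys} (p : x ∈ ys) → Unique ys → Unique (ys without p)
  without-unique (here _) (_ ∷ u) = u
  without-unique (there p) (y≉ys ∷ u) = All-without p y≉ys ∷ without-unique p u

  without-⊆ : ∀ {x ys} (p : x ∈ ys) → ys without p ⊆ ys
  without-⊆ (here _) z∈ = there z∈
  without-⊆ (there p) (here z≈y) = here z≈y
  without-⊆ (there p) (there z∈) = there (without-⊆ p z∈)

  ∉-without : ∀ {x ys} (p : x ∈ ys) → Unique ys → x ∉ ys without p
  ∉-without (here x≈y) (y≉ys ∷ _) x∈ys =
    ∈ₚ.All[≉]⇒∉ setoid y≉ys (∈ₚ.∈-resp-≈ setoid x≈y x∈ys)
  ∉-without (there p) (y≉ys ∷ _) (here x≈y) =
    ∈ₚ.All[≉]⇒∉ setoid y≉ys (∈ₚ.∈-resp-≈ setoid x≈y p)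
  ∉-without (there p) (_ ∷ u) (there x∈) = ∉-without p u x∈

  ∈-without : ∀ {x z ys} (p : x ∈ ys) → z ∈ ys → ¬ z ≈ x → z ∈ ys without p
  ∈-without (here x≈y) (here z≈y) z≉x = ⊥-elim (z≉x (≈-trans z≈y (≈-sym x≈y)))
  ∈-without (here _) (there z∈) _ = z∈
  ∈-without (there p) (here z≈y) _ = here z≈y
  ∈-without (there p) (there z∈) z≉x = there (∈-without p z∈ z≉x)

  sum-unique : ∀ {f} → Respects≈ f → ∀ {xs ys} → Unique xs → Unique ys →
               xs ⊆ ys → ys ⊆ xs → Σ[ f ] xs ≡ Σ[ f ] ys
  sum-unique f-resp {[]} {[]} _ _ _ _ = refl
  sum-unique f-resp {[]} {y ∷ ys} _ _ _ ys⊆[] with ys⊆[] (here ≈-refl)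
  ... | ()
  sum-unique {f} f-resp {x ∷ xs} {ys} (x≉xs ∷ uxs) uys xs⊆ys ys⊆xs = begin
    f x + Σ[ f ] xs                  ≡⟨ cong (f x +_) (sum-unique f-resp uxs (without-unique p uys) xs⊆rest rest⊆xs) ⟩
    f x + Σ[ f ] (ys without p)      ≡⟨ sym (sum-without f-resp ys p) ⟩
    Σ[ f ] ys                        ∎
    where
    open ≡-Reasoning
    p : x ∈ ys
    p = xs⊆ys (here ≈-refl)
    xs⊆rest : xs ⊆ ys without p
    xs⊆rest z∈xs = ∈-without p (xs⊆ys (there z∈xs))
                     (λ z≈x → ∈ₚ.All[≉]⇒∉ setoid x≉xs (∈ₚ.∈-resp-≈ setoid z≈x z∈xs))
    rest⊆xs : ys without p ⊆ xs
    rest⊆xs z∈rest with ys⊆xs (without-⊆ p z∈rest)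
    ... | here z≈x = ⊥-elim (∉-without p uys (∈ₚ.∈-resp-≈ setoid z≈x z∈rest))
    ... | there z∈xs = z∈xs

  sum-distinct-cong : ∀ {f} → Respects≈ f → ∀ {xs ys} → xs ⊆ ys → ys ⊆ xs →
                      Σ[ f ] (distinct xs) ≡ Σ[ f ] (distinct ys)
  sum-distinct-cong f-resp {xs} {ys} xs⊆ys ys⊆xs =
    sum-unique f-resp (distinct-unique xs) (distinct-unique ys)
      (⊆-distinct ∘ xs⊆ys ∘ distinct-⊆) (⊆-distinct ∘ ys⊆xs ∘ distinct-⊆)

  length-as-sum : ∀ xs → length xs ≡ Σ[ (λ _ → 1) ] xs
  length-as-sum [] = refl
  length-as-sum (_ ∷ xs) = cong suc (length-as-sum xs)

  count-distinct-cong : ∀ {xs ys} → xs ⊆ ys → ys ⊆ xs → length (distinct xs) ≡ length (distinct ys)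
  count-distinct-cong {xs} {ys} xs⊆ys ys⊆xs = begin
    length (distinct xs)              ≡⟨ length-as-sum (distinct xs) ⟩
    Σ[ (λ _ → 1) ] (distinct xs)      ≡⟨ sum-distinct-cong (λ _ → refl) xs⊆ys ys⊆xs ⟩
    Σ[ (λ _ → 1) ] (distinct ys)      ≡⟨ sym (length-as-sum (distinct ys)) ⟩
    length (distinct ys)              ∎
    where open ≡-Reasoning

  count-unique : ∀ {xs} → Unique xs → length (distinct xs) ≡ length xs
  count-unique u = cong length (distinct-of-unique u)

  sum-distinct-unique : ∀ {f xs} → Unique xs → Σ[ f ] (distinct xs) ≡ Σ[ f ] xs
  sum-distinct-unique {f} u = cong (Σ[ f ]_) (distinct-of-unique u)

  three≤length : ∀ {a b c ys} → a ∈ ys → b ∈ ys → c ∈ ys → ¬ a ≈ b → ¬ a ≈ c → ¬ b ≈ c → 3 ≤ length ys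
  three≤length {a} {b} {c} {ys} a∈ b∈ c∈ a≉b a≉c b≉c =
    subst (3 ≤_) (sym (length-without ys a∈))
      (s≤s (two≤ (∈-without a∈ b∈ (a≉b ∘ ≈-sym)) (∈-without a∈ c∈ (a≉c ∘ ≈-sym))))
    where
    two≤ : ∀ {zs} → b ∈ zs → c ∈ zs → 2 ≤ length zs
    two≤ {zs} b∈ c∈ = subst (2 ≤_) (sym (length-without zs b∈))
                        (s≤s (nonempty (∈-without b∈ c∈ (b≉c ∘ ≈-sym))))
      where
      nonempty : ∀ {x xs} → x ∈ xs → 1 ≤ length xs
      nonempty {xs = _ ∷ _} _ = s≤s z≤n

module Resolution where

  open import Level using (0ℓ)
  open import Data.Nat using (_≤_)
  open import Data.Nat.Properties using (≤-trans)
  open import Data.Bool using (Bool; not)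
  open import Data.Bool.Properties using (not-involutive)
  open import Data.List using (List; []; _∷_; _++_)
  open import Data.List.Relation.Unary.All as All using (All; []; _∷_)
  open import Data.List.Relation.Unary.All.Properties using (++⁻)
  open import Data.List.Relation.Unary.Any as Any using (here)
  import Data.List.Membership.Setoid.Properties as ∈ₛ
  import Data.List.Relation.Binary.Subset.Setoid.Properties as ⊆ₛ
  open import Function using (_∘_; case_of_)
  open import Data.List.Membership.Propositional using (_∈_; find; lose)
  open import Data.List.Membership.Propositional.Properties using (∈-filter⁺; ∈-filter⁻; ∈-++⁺ˡ; ∈-++⁺ʳ; ∈-++⁻)
  open import Data.Product using (_×_; _,_)
  open import Data.Sum using (inj₁; inj₂; [_,_]′) renaming (map to ⊎-map)
  open import Data.Empty using (⊥; ⊥-elim)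
  open import Data.Unit using (tt)
  open import Relation.Nullary using (yes; no; ¬?)
  open import Relation.Nullary.Decidable using (_×-dec_)
  open import Relation.Binary.PropositionalEquality using (_≡_; _≢_; refl; sym; trans; cong; subst)
  open import Relation.Binary.PropositionalEquality.Properties using (decSetoid)
  open import Relation.Binary.Bundles using (DecSetoid; Setoid)

  compl-involutive : ∀ l → compl (compl l) ≡ l
  compl-involutive (pos x) = refl
  compl-involutive (neg x) = refl

  var-compl : ∀ l → var (compl l) ≡ var l
  var-compl (pos x) = refl
  var-compl (neg x) = refl

  litVal-compl : ∀ φ l → litVal φ (compl l) ≡ not (litVal φ l)
  litVal-compl φ (pos x) = refl
  litVal-compl φ (neg x) = sym (not-involutive (φ x))

  litDecSetoid : DecSetoid 0ℓ 0ℓ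
  litDecSetoid = decSetoid _≟L_

  ≐-refl : ∀ {C} → C ≐ C
  ≐-refl = All.tabulate (λ p → p) , All.tabulate (λ p → p)

  ≐-sym : ∀ {C D} → C ≐ D → D ≐ C
  ≐-sym (C⊆D , D⊆C) = D⊆C , C⊆D

  ≐-trans : ∀ {C D E} → C ≐ D → D ≐ E → C ≐ E
  ≐-trans (C⊆D , D⊆C) (D⊆E , E⊆D) =
    All.map (All.lookup D⊆E) C⊆D , All.map (All.lookup D⊆C) E⊆D

  ≐-∈ : ∀ {C D l} → C ≐ D → l ∈ C → l ∈ D
  ≐-∈ (C⊆D , _) = All.lookup C⊆D

  clauseDecSetoid : DecSetoid 0ℓ 0ℓ
  clauseDecSetoid = record
    { Carrier = Clause
    ; _≈_ = _≐_
    ; isDecEquivalence = record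
      { isEquivalence = record { refl = ≐-refl ; sym = ≐-sym ; trans = ≐-trans }
      ; _≟_ = _≐?_ } }

  module LitD = Distinct litDecSetoid
  module ClauseD = Distinct clauseDecSetoid

  len-≐ : ∀ {C D} → C ≐ D → len C ≡ len D
  len-≐ (C⊆D , D⊆C) = LitD.count-distinct-cong (All.lookup C⊆D) (All.lookup D⊆C)

  three≤len : ∀ {a b c C} → a ∈ C → b ∈ C → c ∈ C → a ≢ b → a ≢ c → b ≢ c → 3 ≤ len C
  three≤len a∈ b∈ c∈ = LitD.three≤length (LitD.⊆-distinct a∈) (LitD.⊆-distinct b∈) (LitD.⊆-distinct c∈)

  ∈-resolvent⁺ : ∀ {C D x l} → l ∈ C ++ D → l ≢ x → l ≢ compl x → l ∈ resolvent C D x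
  ∈-resolvent⁺ {x = x} l∈ l≢x l≢x̄ =
    ∈-filter⁺ (λ l → ¬? (l ≟L x) ×-dec ¬? (l ≟L compl x)) l∈ (l≢x , l≢x̄)

  ∈-resolvent⁻ : ∀ {C D x l} → l ∈ resolvent C D x → (l ∈ C ++ D) × l ≢ x × l ≢ compl x
  ∈-resolvent⁻ {C} {D} {x} l∈ with ∈-filter⁻ (λ l → ¬? (l ≟L x) ×-dec ¬? (l ≟L compl x)) {xs = C ++ D} l∈
  ... | l∈C++D , l≢x , l≢x̄ = l∈C++D , l≢x , l≢x̄

  clash-sym : ∀ {C D x} → Clash C D x → Clash D C (compl x)
  clash-sym {C} {D} {x} (x∈C , x̄∈D , only-x) =
    x̄∈D , subst (_∈ C) (sym (compl-involutive x)) x∈C , only-x̄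
    where
    only-x̄ : ∀ y → y ∈ D → compl y ∈ C → y ≡ compl x
    only-x̄ y y∈D ȳ∈C = trans (sym (compl-involutive y))
      (cong compl (only-x (compl y) ȳ∈C (subst (_∈ D) (sym (compl-involutive y)) y∈D)))

  resolvent-sym : ∀ {C D x} → resolvent C D x ≐ resolvent D C (compl x)
  resolvent-sym {C} {D} {x} = All.tabulate forth , All.tabulate back
    where
    swap : ∀ {l} xs ys → l ∈ xs ++ ys → l ∈ ys ++ xs
    swap xs ys l∈ = [ ∈-++⁺ʳ ys , ∈-++⁺ˡ ]′ (∈-++⁻ xs l∈)
    forth : ∀ {l} → l ∈ resolvent C D x → l ∈ resolvent D C (compl x)
    forth l∈ with ∈-resolvent⁻ {C} {D} l∈
    ... | l∈CD , l≢x , l≢x̄ = ∈-resolvent⁺ {D} {C} (swap C D l∈CD) l≢x̄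
                               (λ e → l≢x (trans e (compl-involutive x)))
    back : ∀ {l} → l ∈ resolvent D C (compl x) → l ∈ resolvent C D x
    back l∈ with ∈-resolvent⁻ {D} {C} l∈
    ... | l∈DC , l≢x̄ , l≢x = ∈-resolvent⁺ {C} {D} (swap D C l∈DC)
                               (λ e → l≢x (trans e (sym (compl-involutive x)))) l≢x̄

  NonTaut : Clause → Set
  NonTaut C = ∀ l → l ∈ C → compl l ∈ C → ⊥

  NonTaut-≐ : ∀ {C D} → C ≐ D → NonTaut D → NonTaut C
  NonTaut-≐ C≐D ntD l l∈ l̄∈ = ntD l (≐-∈ C≐D l∈) (≐-∈ C≐D l̄∈)

  NonTaut-resolvent : ∀ {C D x} → NonTaut C → NonTaut D → Clash C D x → NonTaut (resolvent C D x)
  NonTaut-resolvent {C} {D} {x} ntC ntD (_ , _ , unique-clash) l l∈ l̄∈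
    with ∈-resolvent⁻ {C} {D} l∈ | ∈-resolvent⁻ {C} {D} l̄∈
  ... | l∈CD , l≢x , _ | l̄∈CD , l̄≢x , _ with ∈-++⁻ C l∈CD | ∈-++⁻ C l̄∈CD
  ... | inj₁ l∈C | inj₁ l̄∈C = ntC l l∈C l̄∈C
  ... | inj₂ l∈D | inj₂ l̄∈D = ntD l l∈D l̄∈D
  ... | inj₁ l∈C | inj₂ l̄∈D = l≢x (unique-clash l l∈C l̄∈D)
  ... | inj₂ l∈D | inj₁ l̄∈C =
    l̄≢x (unique-clash (compl l) l̄∈C (subst (_∈ D) (sym (compl-involutive l)) l∈D))

  sat-resolvent : ∀ {C D x E} (φ : Assignment) → NonTaut C → NonTaut D → Clash C D x →
                  E ≐ resolvent C D x → SatClause φ C → SatClause φ D → SatClause φ E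
  sat-resolvent {C} {D} {x} φ ntC ntD (x∈C , x̄∈D , _) (_ , R⊆E) satC satD with find satC
  ... | l , l∈C , l-true with l ≟L x
  ...   | no l≢x with l ≟L compl x
  ...     | yes refl = ⊥-elim (ntC x x∈C l∈C)
  ...     | no l≢x̄ = lose (All.lookup R⊆E (∈-resolvent⁺ {C} {D} (∈-++⁺ˡ l∈C) l≢x l≢x̄)) l-true
  sat-resolvent {C} {D} {x} φ ntC ntD (x∈C , x̄∈D , _) (_ , R⊆E) satC satD | l , l∈C , l-true | yes refl
    with find satD
  ... | k , k∈D , k-true with k ≟L compl l
  ...   | yes refl = case trans (sym k-true) (trans (litVal-compl φ l) (cong not l-true)) of λ ()
  ...   | no k≢l̄ with k ≟L l
  ...     | yes refl = ⊥-elim (ntD k k∈D x̄∈D)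
  ...     | no k≢l = lose (All.lookup R⊆E (∈-resolvent⁺ {C} {D} (∈-++⁺ʳ C k∈D) k≢l k≢l̄)) k-true

  module Soundness {F : ClauseSet} (ntF : All NonTaut F) where

    derived-NonTaut : ∀ {C} → Deriv F C → NonTaut C
    derived-NonTaut (axiom p) = All.lookup ntF p
    derived-NonTaut (res x t₁ t₂ c e) =
      NonTaut-≐ e (NonTaut-resolvent (derived-NonTaut t₁) (derived-NonTaut t₂) c)

    derived-sat : ∀ {C} φ → All (SatClause φ) F → Deriv F C → SatClause φ C
    derived-sat φ satF (axiom p) = All.lookup satF p
    derived-sat φ satF (res x t₁ t₂ c e) =
      sat-resolvent φ (derived-NonTaut t₁) (derived-NonTaut t₂) c e
        (derived-sat φ satF t₁) (derived-sat φ satF t₂)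

    refutation⇒unsat : Refutation F → Unsatisfiable F
    refutation⇒unsat t (φ , satF) with derived-sat φ satF t
    ... | ()

  complementary-units : ∀ {F x} → (pos x ∷ []) ∈ F → (neg x ∷ []) ∈ F → Unsatisfiable F
  complementary-units {x = x} pos∈ neg∈ (φ , satF) with All.lookup satF pos∈ | All.lookup satF neg∈
  ... | here φx≡true | here ¬φx≡true rewrite φx≡true = case ¬φx≡true of λ ()

  root∈labels : ∀ {F C} (t : Deriv F C) → C ∈ labels t
  root∈labels (axiom _) = here refl
  root∈labels (res _ _ _ _ _) = here refl

  width⇒hardness : ∀ k {F C} (t : Deriv F C) → WidthBound k t → HardnessBound k t
  width⇒hardness k (axiom _) _ = tt
  width⇒hardness k (res x t₁ t₂ c e) (_ ∷ rest) with ++⁻ (labels t₁) rest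
  ... | w₁ , w₂ = inj₁ (All.lookup w₁ (root∈labels t₁)) , width⇒hardness k t₁ w₁ , width⇒hardness k t₂ w₂

  hardness-mono : ∀ {j k} → j ≤ k → ∀ {F C} (t : Deriv F C) → HardnessBound j t → HardnessBound k t
  hardness-mono j≤k (axiom _) _ = tt
  hardness-mono j≤k (res x t₁ t₂ c e) (short , h₁ , h₂) =
    ⊎-map (λ p → ≤-trans p j≤k) (λ p → ≤-trans p j≤k) short ,
    hardness-mono j≤k t₁ h₁ , hardness-mono j≤k t₂ h₂

  clauseSetoid : Setoid 0ℓ 0ℓ
  clauseSetoid = DecSetoid.setoid clauseDecSetoid
  open import Data.List.Membership.Setoid clauseSetoid public using () renaming (_∈_ to _∈ᶜ_)
  open import Data.List.Relation.Binary.Subset.Setoid clauseSetoid public using () renaming (_⊆_ to _⊆ᶜ_)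
  open import Data.List.Relation.Unary.Unique.Setoid clauseSetoid public using () renaming (Unique to Uniqueᶜ)

  ++-⊆ᶜ : ∀ {xs ys zs} → xs ⊆ᶜ zs → ys ⊆ᶜ zs → xs ++ ys ⊆ᶜ zs
  ++-⊆ᶜ {xs} xs⊆ ys⊆ z∈ = [ xs⊆ , ys⊆ ]′ (∈ₛ.∈-++⁻ clauseSetoid xs z∈)

  ⊆ᶜ-++ˡ : ∀ {xs ys zs} → xs ⊆ᶜ ys → xs ⊆ᶜ ys ++ zs
  ⊆ᶜ-++ˡ {ys = ys} {zs} xs⊆ = ⊆ₛ.xs⊆xs++ys clauseSetoid ys zs ∘ xs⊆

  ⊆ᶜ-++ʳ : ∀ {xs} ys {zs} → xs ⊆ᶜ zs → xs ⊆ᶜ ys ++ zs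
  ⊆ᶜ-++ʳ ys {zs} xs⊆ = ⊆ₛ.xs⊆ys++xs clauseSetoid zs ys ∘ xs⊆

  singleton-⊆ᶜ : ∀ {C xs} → C ∈ᶜ xs → C ∷ [] ⊆ᶜ xs
  singleton-⊆ᶜ C∈ (here z≐C) = ∈ₛ.∈-resp-≈ clauseSetoid (≐-sym z≐C) C∈

  ∈⇒∈ᶜ : ∀ {C xs} → C ∈ xs → C ∈ᶜ xs
  ∈⇒∈ᶜ = Any.map (λ { refl → ≐-refl })

  ⊆ᶜ-refl : ∀ {xs} → xs ⊆ᶜ xs
  ⊆ᶜ-refl z∈ = z∈

  ⊆⇒⊆ᶜ : ∀ {xs ys} → (∀ {C} → C ∈ xs → C ∈ ys) → xs ⊆ᶜ ys
  ⊆⇒⊆ᶜ xs⊆ys z∈ with find z∈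
  ... | C , C∈ , z≐C = lose (xs⊆ys C∈) z≐C

module Renaming where

  open Resolution
  open import Data.Nat using (ℕ; _+_; _<_)
  open import Data.Nat.ListAction using (sum)
  open import Data.Nat.ListAction.Properties using (sum-++)
  open import Data.Bool using (Bool; not)
  import Data.Bool as 𝔹
  open import Data.List using (List; []; _∷_; _++_; map; filter; length)
  open import Data.List.Properties using (map-++; map-∘; length-map)
  open import Data.List.Relation.Unary.All as All using (All; []; _∷_)
  import Data.List.Relation.Unary.All.Properties as Allₚ
  open import Data.List.Relation.Unary.Any as Any using (here; there)
  open import Data.List.Relation.Unary.AllPairs using (AllPairs; []; _∷_)
  open import Data.List.Membership.Propositional using (_∈_; find; lose)
  open import Data.List.Membership.Propositional.Properties using (∈-map⁺; ∈-map⁻; ∈-++⁻)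
  import Data.List.Membership.Setoid.Properties as ∈ₛ
  import Data.List.Relation.Binary.Subset.Setoid.Properties as ⊆ₛ
  open import Data.Product using (Σ; _×_; _,_; proj₁; proj₂)
  open import Data.Sum using (inj₁; inj₂)
  open import Function using (_∘_)
  open import Relation.Nullary using (¬_; yes; no; ¬?)
  open import Relation.Binary.PropositionalEquality using (_≡_; _≢_; refl; sym; trans; cong; cong₂; subst; module ≡-Reasoning)

  renL : (Var → Var) → Lit → Lit
  renL ρ (pos x) = pos (ρ x)
  renL ρ (neg x) = neg (ρ x)

  ren : (Var → Var) → Clause → Clause
  ren ρ = map (renL ρ)

  var-renL : ∀ ρ l → var (renL ρ l) ≡ ρ (var l)
  var-renL ρ (pos x) = refl
  var-renL ρ (neg x) = refl

  compl-renL : ∀ ρ l → compl (renL ρ l) ≡ renL ρ (compl l)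
  compl-renL ρ (pos x) = refl
  compl-renL ρ (neg x) = refl

  ∈-ren⁺ : ∀ {ρ l C} → l ∈ C → renL ρ l ∈ ren ρ C
  ∈-ren⁺ = ∈-map⁺ _

  ∈-ren⁻ : ∀ {ρ k} C → k ∈ ren ρ C → Σ Lit λ l → l ∈ C × k ≡ renL ρ l
  ∈-ren⁻ C = ∈-map⁻ _

  ⊆-ren : ∀ {ρ} {C D : Clause} → All (_∈ D) C → All (_∈ ren ρ D) (ren ρ C)
  ⊆-ren C⊆D = Allₚ.map⁺ (All.map ∈-ren⁺ C⊆D)

  ren-≐ : ∀ {ρ C D} → C ≐ D → ren ρ C ≐ ren ρ D
  ren-≐ (C⊆D , D⊆C) = ⊆-ren C⊆D , ⊆-ren D⊆C

  -- Renaming by ρ is faithful on clauses all of whose variables lie below K,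
  -- provided ρ is injective below K.
  InjectiveBelow : (Var → Var) → ℕ → Set
  InjectiveBelow ρ K = ∀ a b → a < K → b < K → ρ a ≡ ρ b → a ≡ b

  BoundedLit : ℕ → Lit → Set
  BoundedLit K l = var l < K

  Bounded : ℕ → Clause → Set
  Bounded K C = All (BoundedLit K) C

  bounded-compl : ∀ {K} l → BoundedLit K l → BoundedLit K (compl l)
  bounded-compl (pos x) b = b
  bounded-compl (neg x) b = b

  bounded-++ : ∀ {K C D l} → Bounded K C → Bounded K D → l ∈ C ++ D → BoundedLit K l
  bounded-++ {C = C} bC bD l∈ with ∈-++⁻ C l∈
  ... | inj₁ l∈C = All.lookup bC l∈C
  ... | inj₂ l∈D = All.lookup bD l∈D

  bounded-resolvent : ∀ {K C D x E} → Bounded K C → Bounded K D → E ≐ resolvent C D x → Bounded K E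
  bounded-resolvent {C = C} {D} {x} bC bD (E⊆R , _) =
    All.map (λ l∈R → bounded-++ bC bD (proj₁ (∈-resolvent⁻ {C} {D} {x} l∈R))) E⊆R

  module _ {ρ : Var → Var} {K : ℕ} (inj : InjectiveBelow ρ K) where

    renL-injective : ∀ {l l'} → BoundedLit K l → BoundedLit K l' → renL ρ l ≡ renL ρ l' → l ≡ l'
    renL-injective {pos a} {pos b} ba bb e = cong pos (inj a b ba bb (cong var e))
    renL-injective {neg a} {neg b} ba bb e = cong neg (inj a b ba bb (cong var e))
    renL-injective {pos a} {neg b} _ _ ()
    renL-injective {neg a} {pos b} _ _ ()

    ∈-ren-reflect : ∀ {C l} → Bounded K C → BoundedLit K l → renL ρ l ∈ ren ρ C → l ∈ C
    ∈-ren-reflect {C} bC bl l∈ with ∈-ren⁻ C l∈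
    ... | l' , l'∈C , e = subst (_∈ C) (sym (renL-injective bl (All.lookup bC l'∈C) e)) l'∈C

    ⊆-ren-reflect : ∀ {C D} → Bounded K C → Bounded K D → All (_∈ ren ρ D) (ren ρ C) → All (_∈ D) C
    ⊆-ren-reflect {[]} _ _ _ = []
    ⊆-ren-reflect {l ∷ C} (bl ∷ bC) bD (l∈ ∷ C⊆) = ∈-ren-reflect bD bl l∈ ∷ ⊆-ren-reflect bC bD C⊆

    ren-≐-reflect : ∀ {C D} → Bounded K C → Bounded K D → ren ρ C ≐ ren ρ D → C ≐ D
    ren-≐-reflect bC bD (C⊆D , D⊆C) = ⊆-ren-reflect bC bD C⊆D , ⊆-ren-reflect bD bC D⊆C

    clash-ren : ∀ {C D x} → Bounded K C → Bounded K D → Clash C D x →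
                Clash (ren ρ C) (ren ρ D) (renL ρ x)
    clash-ren {C} {D} {x} bC bD (x∈C , x̄∈D , unique-clash) =
      ∈-ren⁺ x∈C , subst (_∈ ren ρ D) (sym (compl-renL ρ x)) (∈-ren⁺ x̄∈D) , only-x
      where
      only-x : ∀ y → y ∈ ren ρ C → compl y ∈ ren ρ D → y ≡ renL ρ x
      only-x y y∈ ȳ∈ with ∈-ren⁻ C y∈
      ... | l , l∈C , refl = cong (renL ρ) (unique-clash l l∈C
              (∈-ren-reflect bD (bounded-compl l (All.lookup bC l∈C))
                (subst (_∈ ren ρ D) (compl-renL ρ l) ȳ∈)))

    resolvent-ren : ∀ {C D x E} → Bounded K C → Bounded K D → BoundedLit K x →
                    E ≐ resolvent C D x → ren ρ E ≐ resolvent (ren ρ C) (ren ρ D) (renL ρ x)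
    resolvent-ren {C} {D} {x} {E} bC bD bx (E⊆R , R⊆E) = Allₚ.map⁺ (All.map forth E⊆R) , All.tabulate back
      where
      forth : ∀ {l} → l ∈ resolvent C D x → renL ρ l ∈ resolvent (ren ρ C) (ren ρ D) (renL ρ x)
      forth l∈ with ∈-resolvent⁻ {C} {D} l∈
      ... | l∈CD , l≢x , l≢x̄ = ∈-resolvent⁺ {ren ρ C} {ren ρ D}
              (subst (_ ∈_) (map-++ (renL ρ) C D) (∈-ren⁺ l∈CD))
              (λ e → l≢x (renL-injective (bounded-++ bC bD l∈CD) bx e))
              (λ e → l≢x̄ (renL-injective (bounded-++ bC bD l∈CD) (bounded-compl x bx) (trans e (compl-renL ρ x))))
      back : ∀ {k} → k ∈ resolvent (ren ρ C) (ren ρ D) (renL ρ x) → k ∈ ren ρ E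
      back k∈ with ∈-resolvent⁻ {ren ρ C} {ren ρ D} k∈
      ... | k∈CD , k≢x , k≢x̄ with ∈-ren⁻ (C ++ D) (subst (_ ∈_) (sym (map-++ (renL ρ) C D)) k∈CD)
      ...   | l , l∈CD , refl = ∈-ren⁺ (All.lookup R⊆E (∈-resolvent⁺ {C} {D} l∈CD
                (λ e → k≢x (cong (renL ρ) e)) (λ e → k≢x̄ (trans (cong (renL ρ) e) (sym (compl-renL ρ x))))))

    NonTaut-ren : ∀ {D} → Bounded K D → NonTaut D → NonTaut (ren ρ D)
    NonTaut-ren {D} bD ntD k k∈ k̄∈ with ∈-ren⁻ D k∈
    ... | l , l∈D , refl = ntD l l∈D (∈-ren-reflect bD (bounded-compl l (All.lookup bD l∈D))
                              (subst (_∈ ren ρ D) (compl-renL ρ l) k̄∈))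

    len-ren : ∀ {C} → Bounded K C → len (ren ρ C) ≡ len C
    len-ren {C} bC = begin
      len (ren ρ C)                                 ≡⟨ LitD.count-distinct-cong ren⊆ ⊆ren ⟩
      length (LitD.distinct (map (renL ρ) dC))      ≡⟨ LitD.count-unique (unique-map (LitD.distinct-unique C) b-dC) ⟩
      length (map (renL ρ) dC)                      ≡⟨ length-map (renL ρ) dC ⟩
      len C                                         ∎
      where
      open ≡-Reasoning
      dC : Clause
      dC = LitD.distinct C
      b-dC : Bounded K dC
      b-dC = All.tabulate (All.lookup bC ∘ LitD.distinct-⊆)
      ren⊆ : ∀ {k} → k ∈ ren ρ C → k ∈ map (renL ρ) dC
      ren⊆ k∈ with ∈-ren⁻ C k∈
      ... | l , l∈C , refl = ∈-map⁺ (renL ρ) (LitD.⊆-distinct l∈C)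
      ⊆ren : ∀ {k} → k ∈ map (renL ρ) dC → k ∈ ren ρ C
      ⊆ren k∈ with ∈-map⁻ (renL ρ) k∈
      ... | l , l∈dC , refl = ∈-ren⁺ (LitD.distinct-⊆ l∈dC)
      unique-map : ∀ {ls} → AllPairs _≢_ ls → Bounded K ls → AllPairs _≢_ (map (renL ρ) ls)
      unique-map [] [] = []
      unique-map (l≢ls ∷ u) (bl ∷ bls) = Allₚ.map⁺ (distinct-heads bl l≢ls bls) ∷ unique-map u bls
        where
        distinct-heads : ∀ {l ls} → BoundedLit K l → All (l ≢_) ls → Bounded K ls →
                         All (λ k → renL ρ l ≢ renL ρ k) ls
        distinct-heads bl [] [] = []
        distinct-heads bl (l≢k ∷ rest) (bk ∷ bks) = (l≢k ∘ renL-injective bl bk) ∷ distinct-heads bl rest bks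

    unique-ren : ∀ {Cs} → All (Bounded K) Cs → Uniqueᶜ Cs → Uniqueᶜ (map (ren ρ) Cs)
    unique-ren {[]} _ [] = []
    unique-ren {C ∷ Cs} (bC ∷ bCs) (C≉Cs ∷ u) = Allₚ.map⁺ (distinct-heads bCs C≉Cs) ∷ unique-ren bCs u
      where
      distinct-heads : ∀ {Ds} → All (Bounded K) Ds → All (λ D → ¬ C ≐ D) Ds → All (λ D → ¬ ren ρ C ≐ ren ρ D) Ds
      distinct-heads [] [] = []
      distinct-heads (bD ∷ bDs) (C≉D ∷ rest) = (C≉D ∘ ren-≐-reflect bC bD) ∷ distinct-heads bDs rest

  -- X₀ commutes with renaming, since renaming keeps signs and the sign parity.
  allSigns-map : ∀ ρ xs → allSigns (map ρ xs) ≡ map (ren ρ) (allSigns xs)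
  allSigns-map ρ [] = refl
  allSigns-map ρ (x ∷ xs) = begin
    map (pos (ρ x) ∷_) (allSigns (map ρ xs)) ++ map (neg (ρ x) ∷_) (allSigns (map ρ xs))
      ≡⟨ cong (λ S → map (pos (ρ x) ∷_) S ++ map (neg (ρ x) ∷_) S) (allSigns-map ρ xs) ⟩
    map (pos (ρ x) ∷_) (map (ren ρ) S) ++ map (neg (ρ x) ∷_) (map (ren ρ) S)
      ≡⟨ cong₂ _++_ (sym (map-∘ S)) (sym (map-∘ S)) ⟩
    map (ren ρ ∘ (pos x ∷_)) S ++ map (ren ρ ∘ (neg x ∷_)) S
      ≡⟨ cong₂ _++_ (map-∘ S) (map-∘ S) ⟩
    map (ren ρ) (map (pos x ∷_) S) ++ map (ren ρ) (map (neg x ∷_) S)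
      ≡⟨ sym (map-++ (ren ρ) (map (pos x ∷_) S) _) ⟩
    map (ren ρ) (map (pos x ∷_) S ++ map (neg x ∷_) S)   ∎
    where
    open ≡-Reasoning
    S : List Clause
    S = allSigns xs

  negParity-ren : ∀ ρ D → negParity (ren ρ D) ≡ negParity D
  negParity-ren ρ [] = refl
  negParity-ren ρ (pos x ∷ D) = negParity-ren ρ D
  negParity-ren ρ (neg x ∷ D) = cong not (negParity-ren ρ D)

  filter-parity-ren : ∀ ρ b (Ds : List Clause) →
    filter (λ D → ¬? (negParity D 𝔹.≟ b)) (map (ren ρ) Ds) ≡ map (ren ρ) (filter (λ D → ¬? (negParity D 𝔹.≟ b)) Ds)
  filter-parity-ren ρ b [] = refl
  filter-parity-ren ρ b (D ∷ Ds) rewrite negParity-ren ρ D with negParity D 𝔹.≟ b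
  ... | yes _ = filter-parity-ren ρ b Ds
  ... | no _ = cong (ren ρ D ∷_) (filter-parity-ren ρ b Ds)

  map-var-ren : ∀ ρ C → map var (ren ρ C) ≡ map ρ (map var C)
  map-var-ren ρ [] = refl
  map-var-ren ρ (l ∷ C) = cong₂ _∷_ (var-renL ρ l) (map-var-ren ρ C)

  X0-ren : ∀ ρ E → X0 (ren ρ E) ≡ map (ren ρ) (X0 E)
  X0-ren ρ E rewrite map-var-ren ρ E | allSigns-map ρ (map var E) | negParity-ren ρ E =
    filter-parity-ren ρ (negParity E) (allSigns (map var E))

  litVal-ren : ∀ ψ φ ρ l → ψ (var l) ≡ φ (ρ (var l)) → litVal ψ l ≡ litVal φ (renL ρ l)
  litVal-ren ψ φ ρ (pos x) e = e
  litVal-ren ψ φ ρ (neg x) e = cong not e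

  sat-ren : ∀ {K} ψ φ ρ → (∀ a → a < K → ψ a ≡ φ (ρ a)) → ∀ {D} → Bounded K D →
            SatClause ψ D → SatClause φ (ren ρ D)
  sat-ren ψ φ ρ ψ≡φρ bD satD with find satD
  ... | l , l∈D , l-true =
    lose (∈-ren⁺ l∈D) (trans (sym (litVal-ren ψ φ ρ l (ψ≡φρ (var l) (All.lookup bD l∈D)))) l-true)

  map-ren-⊆ᶜ : ∀ ρ {xs ys} → xs ⊆ᶜ ys → map (ren ρ) xs ⊆ᶜ map (ren ρ) ys
  map-ren-⊆ᶜ ρ = ⊆ₛ.map⁺ clauseSetoid clauseSetoid ren-≐

  map-ren-++ : ∀ ρ xs ys → map (ren ρ) (xs ++ ys) ⊆ᶜ map (ren ρ) xs ++ map (ren ρ) ys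
  map-ren-++ ρ xs ys = subst (_ ∈ᶜ_) (map-++ (ren ρ) xs ys)

  leaves : ∀ {F C} → Deriv F C → List (Σ Clause (_∈ F))
  leaves (axiom {C} p) = (C , p) ∷ []
  leaves (res _ t₁ t₂ _ _) = leaves t₁ ++ leaves t₂

  labels-child₁ : ∀ {E} xs ys → xs ⊆ᶜ E ∷ (xs ++ ys)
  labels-child₁ xs ys = there ∘ ⊆ₛ.xs⊆xs++ys clauseSetoid xs ys

  labels-child₂ : ∀ {E} xs ys → ys ⊆ᶜ E ∷ (xs ++ ys)
  labels-child₂ xs ys = there ∘ ⊆ₛ.xs⊆ys++xs clauseSetoid ys xs

  module Transport {ρ K} (inj : InjectiveBelow ρ K) {F G : ClauseSet} (bF : All (Bounded K) F)
                   (hyp : ∀ {D} → D ∈ F → Deriv G (ren ρ D)) where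

    bounded-derived : ∀ {C} → Deriv F C → Bounded K C
    bounded-derived (axiom p) = All.lookup bF p
    bounded-derived (res x t₁ t₂ c e) = bounded-resolvent (bounded-derived t₁) (bounded-derived t₂) e

    transport : ∀ {C} → Deriv F C → Deriv G (ren ρ C)
    transport (axiom p) = hyp p
    transport (res {C₁} {C₂} x t₁ t₂ c e) = res (renL ρ x) (transport t₁) (transport t₂)
      (clash-ren inj b₁ b₂ c) (resolvent-ren inj b₁ b₂ (All.lookup b₁ (proj₁ c)) e)
      where b₁ : Bounded K C₁
            b₁ = bounded-derived t₁
            b₂ : Bounded K C₂
            b₂ = bounded-derived t₂

    labels-⊇ : ∀ {C} (t : Deriv F C) → map (ren ρ) (labels t) ⊆ᶜ labels (transport t)
    labels-⊇ (axiom p) (here z≐) = Any.map (λ { refl → z≐ }) (root∈labels (hyp p))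
    labels-⊇ (res x t₁ t₂ c e) (here z≐) = here z≐
    labels-⊇ (res x t₁ t₂ c e) (there z∈)
      with ∈ₛ.∈-++⁻ clauseSetoid (map (ren ρ) (labels t₁)) (subst (_ ∈ᶜ_) (map-++ (ren ρ) (labels t₁) (labels t₂)) z∈)
    ... | inj₁ z∈₁ = labels-child₁ (labels (transport t₁)) (labels (transport t₂)) (labels-⊇ t₁ z∈₁)
    ... | inj₂ z∈₂ = labels-child₂ (labels (transport t₁)) (labels (transport t₂)) (labels-⊇ t₂ z∈₂)

    labels-⊆ : ∀ X → (∀ {D} (p : D ∈ F) → labels (hyp p) ⊆ᶜ X) →
               ∀ {C} (t : Deriv F C) → labels (transport t) ⊆ᶜ map (ren ρ) (labels t) ++ X
    labels-⊆ X hyp⊆X (axiom p) = ⊆ₛ.xs⊆ys++xs clauseSetoid X _ ∘ hyp⊆X p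
    labels-⊆ X hyp⊆X (res x t₁ t₂ c e) (here z≐) = here z≐
    labels-⊆ X hyp⊆X (res x t₁ t₂ c e) (there z∈) with ∈ₛ.∈-++⁻ clauseSetoid (labels (transport t₁)) z∈
    ... | inj₁ z∈₁ = ⊆ₛ.++⁺ˡ clauseSetoid X (map-ren-⊆ᶜ ρ (labels-child₁ (labels t₁) (labels t₂))) (labels-⊆ X hyp⊆X t₁ z∈₁)
    ... | inj₂ z∈₂ = ⊆ₛ.++⁺ˡ clauseSetoid X (map-ren-⊆ᶜ ρ (labels-child₂ (labels t₁) (labels t₂))) (labels-⊆ X hyp⊆X t₂ z∈₂)

    leaf-labels-⊆ : ∀ {C} (t : Deriv F C) →
      All (λ leaf → labels (hyp (proj₂ leaf)) ⊆ᶜ labels (transport t)) (leaves t)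
    leaf-labels-⊆ (axiom p) = ⊆ᶜ-refl ∷ []
    leaf-labels-⊆ (res x t₁ t₂ c e) = Allₚ.++⁺
      (All.map (λ sub {z} z∈ → labels-child₁ (labels (transport t₁)) (labels (transport t₂)) (sub z∈)) (leaf-labels-⊆ t₁))
      (All.map (λ sub {z} z∈ → labels-child₂ (labels (transport t₁)) (labels (transport t₂)) (sub z∈)) (leaf-labels-⊆ t₂))

  lengths-ren : ∀ {Q : ℕ → Set} {ρ K} → InjectiveBelow ρ K → ∀ {Cs} → All (Bounded K) Cs →
                All (Q ∘ len) Cs → All (Q ∘ len ∘ ren ρ) Cs
  lengths-ren {Q} inj [] [] = []
  lengths-ren {Q} inj (bC ∷ bCs) (q ∷ qs) = subst Q (sym (len-ren inj bC)) q ∷ lengths-ren {Q} inj bCs qs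

  nonTaut-ren : ∀ {ρ K} → InjectiveBelow ρ K → ∀ {Cs} → All (Bounded K) Cs → All NonTaut Cs → All (NonTaut ∘ ren ρ) Cs
  nonTaut-ren inj bCs ntCs = All.zipWith (λ (bC , ntC) → NonTaut-ren inj bC ntC) (bCs , ntCs)

  Σlen : List Clause → ℕ
  Σlen = ClauseD.Σ[ len ]_

  Σlen-++ : ∀ xs ys → Σlen (xs ++ ys) ≡ Σlen xs + Σlen ys
  Σlen-++ xs ys = trans (cong sum (map-++ len xs ys)) (sum-++ (map len xs) (map len ys))

  Σlen-ren : ∀ {ρ K} → InjectiveBelow ρ K → ∀ {Cs} → All (Bounded K) Cs → Σlen (map (ren ρ) Cs) ≡ Σlen Cs
  Σlen-ren inj [] = refl
  Σlen-ren inj (bC ∷ bCs) = cong₂ _+_ (len-ren inj bC) (Σlen-ren inj bCs)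

module Gadgets where

  open Resolution
  open Renaming using (Bounded)
  open import Data.Nat using (ℕ; _≤_; _<_; _≟_; _≤?_; _<?_)
  open import Data.Bool using (Bool; true; false; not)
  import Data.Bool as 𝔹
  open import Data.List using (List; []; _∷_; _++_; length; concatMap; map)
  open import Data.List.Relation.Unary.All as All using (All; all?)
  open import Data.List.Relation.Unary.Any using (Any; any?; here; there)
  open import Data.List.Relation.Unary.AllPairs using (allPairs?)
  open import Data.List.Membership.Propositional using (_∈_)
  import Data.List.Membership.DecPropositional as DecMembership
  open import Data.List.Relation.Binary.Subset.DecSetoid clauseDecSetoid using (_⊆?_)
  open import Data.List.Properties using (≡-dec)
  open import Data.Product using (_×_; _,_)
  open import Data.Sum using (_⊎_)
  open import Relation.Nullary using (Dec; no; ¬?)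
  open import Relation.Nullary.Decidable using (True; toWitness; from-yes; map′; _×-dec_; _⊎-dec_; _→-dec_)
  open import Data.Empty using (⊥)
  open import Relation.Binary.PropositionalEquality using (_≡_; _≢_; refl)

  _∈ₗ?_ : (l : Lit) (C : Clause) → Dec (l ∈ C)
  l ∈ₗ? C = DecMembership._∈?_ _≟L_ l C

  _∈ᶠ?_ : (C : Clause) (F : ClauseSet) → Dec (C ∈ F)
  C ∈ᶠ? F = DecMembership._∈?_ (≡-dec _≟L_) C F

  clash? : ∀ C D x → Dec ((x ∈ C) × (compl x ∈ D) × All (λ y → compl y ∈ D → y ≡ x) C)
  clash? C D x = (x ∈ₗ? C) ×-dec (compl x ∈ₗ? D) ×-dec all? (λ y → (compl y ∈ₗ? D) →-dec (y ≟L x)) C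

  resolve : ∀ {F C D} (x : Lit) → Deriv F C → Deriv F D → (E : Clause) →
            {_ : True (clash? C D x)} → {_ : True (E ≐? resolvent C D x)} → Deriv F E
  resolve {C = C} {D} x t₁ t₂ E {clash} {eq} with toWitness clash
  ... | x∈C , x̄∈D , only-x =
    res x t₁ t₂ (x∈C , x̄∈D , λ y y∈C ȳ∈D → All.lookup only-x y∈C ȳ∈D) (toWitness eq)

  axiomᵈ : ∀ {F} (C : Clause) → {_ : True (C ∈ᶠ? F)} → Deriv F C
  axiomᵈ C {p} = axiom (toWitness p)

  uniqueᶜ? : (Cs : List Clause) → Dec (Uniqueᶜ Cs)
  uniqueᶜ? = allPairs? (λ C D → ¬? (C ≐? D))

  bounded? : ∀ K (Cs : List Clause) → Dec (All (Bounded K) Cs)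
  bounded? K = all? (all? (λ l → var l <? K))

  nonTaut? : ∀ C → Dec (NonTaut C)
  nonTaut? C = map′ (λ no-compl l l∈ l̄∈ → All.lookup no-compl l∈ l̄∈)
                    (λ nt → All.tabulate (λ {l} l∈ → nt l l∈))
                    (all? (λ l → ¬? (compl l ∈ₗ? C)) C)

  LengthIn : ℕ → ℕ → Clause → Set
  LengthIn lo hi C = lo ≤ len C × len C ≤ hi

  lengthIn? : ∀ lo hi C → Dec (LengthIn lo hi C)
  lengthIn? lo hi C = (lo ≤? len C) ×-dec (len C ≤? hi)

  Occurs : ClauseSet → Var → Set
  Occurs F a = Any (Any (λ l → var l ≡ a)) F

  occurs? : ∀ F a → Dec (Occurs F a)
  occurs? F a = any? (any? (λ l → var l ≟ a)) F

  Shape : ℕ → Clause → Set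
  Shape j (a ∷ b ∷ c ∷ []) = var a < j × var b < j × var a ≢ var b × var a ≢ var c × var b ≢ var c
  Shape j _ = ⊥

  shape? : ∀ j C → Dec (Shape j C)
  shape? j (a ∷ b ∷ c ∷ []) =
    (var a <? j) ×-dec (var b <? j) ×-dec ¬? (var a ≟ var b) ×-dec ¬? (var a ≟ var c) ×-dec ¬? (var b ≟ var c)
  shape? j [] = no (λ ())
  shape? j (_ ∷ []) = no (λ ())
  shape? j (_ ∷ _ ∷ []) = no (λ ())
  shape? j (_ ∷ _ ∷ _ ∷ _ ∷ _) = no (λ ())

  -- T₂: local variables 0 = v₁, 1 = v₂.  Seven clauses refute it.
  module Two where

    axioms : ClauseSet
    axioms = X0 (pos 0 ∷ pos 1 ∷ []) ++ X0 (pos 0 ∷ neg 1 ∷ [])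

    refutation : Deriv axioms []
    refutation =
      resolve (pos 0)
        (resolve (pos 1) (axiomᵈ (pos 0 ∷ pos 1 ∷ [])) (axiomᵈ (pos 0 ∷ neg 1 ∷ [])) (pos 0 ∷ []))
        (resolve (pos 1) (axiomᵈ (neg 0 ∷ pos 1 ∷ [])) (axiomᵈ (neg 0 ∷ neg 1 ∷ [])) (neg 0 ∷ []))
        []

    proofClauses : List Clause
    proofClauses = axioms ++ (pos 0 ∷ []) ∷ (neg 0 ∷ []) ∷ [] ∷ []

    proofClauses-⊆ : labels refutation ⊆ᶜ proofClauses
    proofClauses-⊆ = from-yes (labels refutation ⊆? proofClauses)
    ⊆-proofClauses : proofClauses ⊆ᶜ labels refutation
    ⊆-proofClauses = from-yes (proofClauses ⊆? labels refutation)
    proofClauses-unique : Uniqueᶜ proofClauses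
    proofClauses-unique = from-yes (uniqueᶜ? proofClauses)
    proofClauses-bounded : All (Bounded 2) proofClauses
    proofClauses-bounded = from-yes (bounded? 2 proofClauses)

    axioms-⊆ : axioms ⊆ᶜ proofClauses
    axioms-⊆ = from-yes (axioms ⊆? proofClauses)
    axioms-unique : Uniqueᶜ axioms
    axioms-unique = from-yes (uniqueᶜ? axioms)
    axioms-bounded : All (Bounded 2) axioms
    axioms-bounded = from-yes (bounded? 2 axioms)
    axioms-nonTaut : All NonTaut axioms
    axioms-nonTaut = from-yes (all? nonTaut? axioms)
    axioms-lengths : All (LengthIn 2 3) axioms
    axioms-lengths = from-yes (all? (lengthIn? 2 3) axioms)
    axioms-variables : All (_∈ 0 ∷ 1 ∷ []) (concatMap (map var) axioms)
    axioms-variables = from-yes (all? (λ a → DecMembership._∈?_ _≟_ a (0 ∷ 1 ∷ [])) (concatMap (map var) axioms))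

  -- The two clauses y ∨ ¬y' and ¬y ∨ y' (over local variables 0 = y, 1 = y')
  -- expressing y = y'; each block of the chain derives them for the next pair.
  link⁺ link⁻ : Clause
  link⁺ = pos 0 ∷ neg 1 ∷ []
  link⁻ = neg 0 ∷ pos 1 ∷ []

  -- Start of the chain: local variables 0 = v₁, 1 = v₂, 2 = y₂, 3 = y'₂;
  -- from v₁ ⊕ v₂ ⊕ y₂ = 0 and v₁ ⊕ v₂ ⊕ y'₂ = 0 derive y₂ = y'₂.
  module Start where

    xor₁ xor₂ : Clause
    xor₁ = pos 0 ∷ pos 1 ∷ pos 2 ∷ []
    xor₂ = pos 0 ∷ pos 1 ∷ pos 3 ∷ []

    axioms : ClauseSet
    axioms = X0 xor₁ ++ X0 xor₂

    derive⁺ : Deriv axioms (pos 2 ∷ neg 3 ∷ [])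
    derive⁺ = resolve (pos 0)
      (resolve (neg 1) (axiomᵈ (pos 0 ∷ neg 1 ∷ pos 2 ∷ [])) (axiomᵈ (pos 0 ∷ pos 1 ∷ neg 3 ∷ [])) (pos 0 ∷ pos 2 ∷ neg 3 ∷ []))
      (resolve (pos 1) (axiomᵈ (neg 0 ∷ pos 1 ∷ pos 2 ∷ [])) (axiomᵈ (neg 0 ∷ neg 1 ∷ neg 3 ∷ [])) (neg 0 ∷ pos 2 ∷ neg 3 ∷ []))
      _

    derive⁻ : Deriv axioms (neg 2 ∷ pos 3 ∷ [])
    derive⁻ = resolve (pos 0)
      (resolve (pos 1) (axiomᵈ (pos 0 ∷ pos 1 ∷ neg 2 ∷ [])) (axiomᵈ (pos 0 ∷ neg 1 ∷ pos 3 ∷ [])) (pos 0 ∷ neg 2 ∷ pos 3 ∷ []))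
      (resolve (neg 1) (axiomᵈ (neg 0 ∷ neg 1 ∷ neg 2 ∷ [])) (axiomᵈ (neg 0 ∷ pos 1 ∷ pos 3 ∷ [])) (neg 0 ∷ neg 2 ∷ pos 3 ∷ []))
      _

    proofClauses : List Clause
    proofClauses = axioms ++
      (pos 0 ∷ pos 2 ∷ neg 3 ∷ []) ∷ (neg 0 ∷ pos 2 ∷ neg 3 ∷ []) ∷ (pos 2 ∷ neg 3 ∷ []) ∷
      (pos 0 ∷ neg 2 ∷ pos 3 ∷ []) ∷ (neg 0 ∷ neg 2 ∷ pos 3 ∷ []) ∷ (neg 2 ∷ pos 3 ∷ []) ∷ []

    proofClauses-⊆ : labels derive⁺ ++ labels derive⁻ ⊆ᶜ proofClauses
    proofClauses-⊆ = from-yes ((labels derive⁺ ++ labels derive⁻) ⊆? proofClauses)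
    ⊆-proofClauses : proofClauses ⊆ᶜ labels derive⁺ ++ labels derive⁻
    ⊆-proofClauses = from-yes (proofClauses ⊆? (labels derive⁺ ++ labels derive⁻))
    proofClauses-unique : Uniqueᶜ proofClauses
    proofClauses-unique = from-yes (uniqueᶜ? proofClauses)
    proofClauses-bounded : All (Bounded 4) proofClauses
    proofClauses-bounded = from-yes (bounded? 4 proofClauses)
    proofClauses-lengths : All (LengthIn 2 3) proofClauses
    proofClauses-lengths = from-yes (all? (lengthIn? 2 3) proofClauses)

    axioms-⊆ : axioms ⊆ᶜ proofClauses
    axioms-⊆ = from-yes (axioms ⊆? proofClauses)
    axioms-unique : Uniqueᶜ axioms
    axioms-unique = from-yes (uniqueᶜ? axioms)
    axioms-bounded : All (Bounded 4) axioms
    axioms-bounded = from-yes (bounded? 4 axioms)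
    axioms-lengths : All (LengthIn 2 3) axioms
    axioms-lengths = from-yes (all? (lengthIn? 2 3) axioms)
    axioms-nonTaut : All NonTaut axioms
    axioms-nonTaut = from-yes (all? nonTaut? axioms)
    axioms-shape : All (Shape 2) axioms
    axioms-shape = from-yes (all? (shape? 2) axioms)
    axioms-variables : All (Occurs axioms) (0 ∷ 1 ∷ 2 ∷ 3 ∷ [])
    axioms-variables = from-yes (all? (occurs? axioms) (0 ∷ 1 ∷ 2 ∷ 3 ∷ []))

  -- A step of the chain: local variables 0 = y_{i-1}, 1 = y'_{i-1}, 2 = vᵢ,
  -- 3 = yᵢ, 4 = y'ᵢ.  From y_{i-1} = y'_{i-1} (the two link clauses) and
  -- y_{i-1} ⊕ vᵢ ⊕ yᵢ = 0, y'_{i-1} ⊕ vᵢ ⊕ y'ᵢ = 0 derive yᵢ = y'ᵢ.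
  module Step where

    xor₁ xor₂ : Clause
    xor₁ = pos 0 ∷ pos 2 ∷ pos 3 ∷ []
    xor₂ = pos 1 ∷ pos 2 ∷ pos 4 ∷ []

    axioms : ClauseSet
    axioms = X0 xor₁ ++ X0 xor₂

    hypotheses : ClauseSet
    hypotheses = link⁺ ∷ link⁻ ∷ axioms

    derive⁺ : Deriv hypotheses (pos 3 ∷ neg 4 ∷ [])
    derive⁺ = resolve (pos 2)
      (resolve (pos 0) (resolve (neg 1) (axiom (here refl)) (axiomᵈ (pos 1 ∷ pos 2 ∷ neg 4 ∷ [])) (pos 0 ∷ pos 2 ∷ neg 4 ∷ []))
                       (axiomᵈ (neg 0 ∷ pos 2 ∷ pos 3 ∷ [])) (pos 2 ∷ neg 4 ∷ pos 3 ∷ []))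
      (resolve (neg 0) (resolve (pos 1) (axiom (there (here refl))) (axiomᵈ (neg 1 ∷ neg 2 ∷ neg 4 ∷ [])) (neg 0 ∷ neg 2 ∷ neg 4 ∷ []))
                       (axiomᵈ (pos 0 ∷ neg 2 ∷ pos 3 ∷ [])) (neg 2 ∷ neg 4 ∷ pos 3 ∷ []))
      _

    derive⁻ : Deriv hypotheses (neg 3 ∷ pos 4 ∷ [])
    derive⁻ = resolve (pos 2)
      (resolve (neg 0) (resolve (pos 1) (axiom (there (here refl))) (axiomᵈ (neg 1 ∷ pos 2 ∷ pos 4 ∷ [])) (neg 0 ∷ pos 2 ∷ pos 4 ∷ []))
                       (axiomᵈ (pos 0 ∷ pos 2 ∷ neg 3 ∷ [])) (pos 2 ∷ pos 4 ∷ neg 3 ∷ []))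
      (resolve (pos 0) (resolve (neg 1) (axiom (here refl)) (axiomᵈ (pos 1 ∷ neg 2 ∷ pos 4 ∷ [])) (pos 0 ∷ neg 2 ∷ pos 4 ∷ []))
                       (axiomᵈ (neg 0 ∷ neg 2 ∷ neg 3 ∷ [])) (neg 2 ∷ pos 4 ∷ neg 3 ∷ []))
      _

    -- The 18 clauses of derive⁺ and derive⁻ other than the two hypotheses.
    proofClauses : List Clause
    proofClauses = axioms ++
      (pos 0 ∷ pos 2 ∷ neg 4 ∷ []) ∷ (pos 2 ∷ neg 4 ∷ pos 3 ∷ []) ∷ (neg 0 ∷ neg 2 ∷ neg 4 ∷ []) ∷
      (neg 2 ∷ neg 4 ∷ pos 3 ∷ []) ∷ (pos 3 ∷ neg 4 ∷ []) ∷
      (neg 0 ∷ pos 2 ∷ pos 4 ∷ []) ∷ (pos 2 ∷ pos 4 ∷ neg 3 ∷ []) ∷ (pos 0 ∷ neg 2 ∷ pos 4 ∷ []) ∷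
      (neg 2 ∷ pos 4 ∷ neg 3 ∷ []) ∷ (neg 3 ∷ pos 4 ∷ []) ∷ []

    -- Every clause of the step mentions a variable it introduces (2, 3 or 4).
    Fresh : Clause → Set
    Fresh D = Any (λ l → 2 ≤ var l × var l < 5) D

    fresh? : ∀ D → Dec (Fresh D)
    fresh? D = any? (λ l → (2 ≤? var l) ×-dec (var l <? 5)) D

    proofClauses-⊆ : labels derive⁺ ++ labels derive⁻ ⊆ᶜ proofClauses ++ link⁺ ∷ link⁻ ∷ []
    proofClauses-⊆ = from-yes ((labels derive⁺ ++ labels derive⁻) ⊆? (proofClauses ++ link⁺ ∷ link⁻ ∷ []))
    ⊆-proofClauses : proofClauses ⊆ᶜ labels derive⁺ ++ labels derive⁻
    ⊆-proofClauses = from-yes (proofClauses ⊆? (labels derive⁺ ++ labels derive⁻))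
    proofClauses-unique : Uniqueᶜ proofClauses
    proofClauses-unique = from-yes (uniqueᶜ? proofClauses)
    proofClauses-bounded : All (Bounded 5) proofClauses
    proofClauses-bounded = from-yes (bounded? 5 proofClauses)
    proofClauses-lengths : All (LengthIn 2 3) proofClauses
    proofClauses-lengths = from-yes (all? (lengthIn? 2 3) proofClauses)
    proofClauses-fresh : All Fresh proofClauses
    proofClauses-fresh = from-yes (all? fresh? proofClauses)

    hypotheses-bounded : All (Bounded 5) hypotheses
    hypotheses-bounded = from-yes (bounded? 5 hypotheses)
    axioms-⊆ : axioms ⊆ᶜ proofClauses
    axioms-⊆ = from-yes (axioms ⊆? proofClauses)
    axioms-unique : Uniqueᶜ axioms
    axioms-unique = from-yes (uniqueᶜ? axioms)
    axioms-bounded : All (Bounded 5) axioms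
    axioms-bounded = from-yes (bounded? 5 axioms)
    axioms-lengths : All (LengthIn 2 3) axioms
    axioms-lengths = from-yes (all? (lengthIn? 2 3) axioms)
    axioms-fresh : All Fresh axioms
    axioms-fresh = from-yes (all? fresh? axioms)
    axioms-nonTaut : All NonTaut axioms
    axioms-nonTaut = from-yes (all? nonTaut? axioms)
    axioms-shape : All (Shape 3) axioms
    axioms-shape = from-yes (all? (shape? 3) axioms)
    axioms-variables : All (Occurs axioms) (2 ∷ 3 ∷ 4 ∷ [])
    axioms-variables = from-yes (all? (occurs? axioms) (2 ∷ 3 ∷ 4 ∷ []))

  -- End of the chain: local variables 0 = y_{n-1}, 1 = y'_{n-1}, 2 = vₙ.
  -- With y_{n-1} = y'_{n-1}, the constraints y_{n-1} ⊕ vₙ = 0 and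
  -- y'_{n-1} ⊕ v̄ₙ = 0 are contradictory.
  module Final where

    xor₁ xor₂ : Clause
    xor₁ = pos 0 ∷ pos 2 ∷ []
    xor₂ = pos 1 ∷ neg 2 ∷ []

    axioms : ClauseSet
    axioms = X0 xor₁ ++ X0 xor₂

    hypotheses : ClauseSet
    hypotheses = link⁺ ∷ link⁻ ∷ axioms

    refutation : Deriv hypotheses []
    refutation = resolve (pos 0)
      (resolve (pos 2) (resolve (neg 1) (resolve (pos 0) (axiom (here refl)) (axiomᵈ (neg 0 ∷ pos 2 ∷ [])) (neg 1 ∷ pos 2 ∷ []))
                                        (axiomᵈ (pos 1 ∷ pos 2 ∷ [])) (pos 2 ∷ []))
                       (axiomᵈ (pos 0 ∷ neg 2 ∷ [])) (pos 0 ∷ []))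
      (resolve (neg 2) (resolve (pos 1) (resolve (neg 0) (axiom (there (here refl))) (axiomᵈ (pos 0 ∷ neg 2 ∷ [])) (pos 1 ∷ neg 2 ∷ []))
                                        (axiomᵈ (neg 1 ∷ neg 2 ∷ [])) (neg 2 ∷ []))
                       (axiomᵈ (neg 0 ∷ pos 2 ∷ [])) (neg 0 ∷ []))
      []

    -- The 11 clauses of the refutation other than the two hypotheses.
    proofClauses : List Clause
    proofClauses = axioms ++ (neg 1 ∷ pos 2 ∷ []) ∷ (pos 2 ∷ []) ∷ (pos 1 ∷ neg 2 ∷ []) ∷ (neg 2 ∷ []) ∷
                             (pos 0 ∷ []) ∷ (neg 0 ∷ []) ∷ [] ∷ []

    -- Each clause mentions vₙ or has at most one literal, so it is not a clause of the chain.
    Fresh : Clause → Set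
    Fresh D = Any (λ l → var l ≡ 2) D ⊎ len D ≤ 1

    fresh? : ∀ D → Dec (Fresh D)
    fresh? D = any? (λ l → var l ≟ 2) D ⊎-dec (len D ≤? 1)

    proofClauses-⊆ : labels refutation ⊆ᶜ proofClauses ++ link⁺ ∷ link⁻ ∷ []
    proofClauses-⊆ = from-yes (labels refutation ⊆? (proofClauses ++ link⁺ ∷ link⁻ ∷ []))
    ⊆-proofClauses : proofClauses ⊆ᶜ labels refutation
    ⊆-proofClauses = from-yes (proofClauses ⊆? labels refutation)
    proofClauses-unique : Uniqueᶜ proofClauses
    proofClauses-unique = from-yes (uniqueᶜ? proofClauses)
    proofClauses-bounded : All (Bounded 3) proofClauses
    proofClauses-bounded = from-yes (bounded? 3 proofClauses)
    proofClauses-lengths : All (LengthIn 0 3) proofClauses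
    proofClauses-lengths = from-yes (all? (lengthIn? 0 3) proofClauses)
    proofClauses-fresh : All Fresh proofClauses
    proofClauses-fresh = from-yes (all? fresh? proofClauses)

    hypotheses-bounded : All (Bounded 3) hypotheses
    hypotheses-bounded = from-yes (bounded? 3 hypotheses)
    axioms-⊆ : axioms ⊆ᶜ proofClauses
    axioms-⊆ = from-yes (axioms ⊆? proofClauses)
    axioms-unique : Uniqueᶜ axioms
    axioms-unique = from-yes (uniqueᶜ? axioms)
    axioms-bounded : All (Bounded 3) axioms
    axioms-bounded = from-yes (bounded? 3 axioms)
    axioms-lengths : All (LengthIn 2 3) axioms
    axioms-lengths = from-yes (all? (lengthIn? 2 3) axioms)
    axioms-fresh : All Fresh axioms
    axioms-fresh = from-yes (all? fresh? axioms)
    axioms-nonTaut : All NonTaut axioms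
    axioms-nonTaut = from-yes (all? nonTaut? axioms)
    axioms-variables : All (Occurs axioms) (2 ∷ [])
    axioms-variables = from-yes (all? (occurs? axioms) (2 ∷ []))

    -- The assignments y_{n-1} = vₙ = b, y'_{n-1} = ¬b satisfy the final axioms.
    ψ : Bool → Assignment
    ψ b 0 = b
    ψ b 1 = not b
    ψ b _ = b

    axioms-sat : ∀ b → All (SatClause (ψ b)) axioms
    axioms-sat true = from-yes (all? (any? (λ l → litVal (ψ true) l 𝔹.≟ true)) axioms)
    axioms-sat false = from-yes (all? (any? (λ l → litVal (ψ false) l 𝔹.≟ true)) axioms)

-- Placing gadgets into Tₙ: a list of distinct relevant names turns local
-- variable i into the variable of the i-th name, injectively.
module Placement (n : ℕ) (nm : VName → Var) (dn : DistinctNames n nm) where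

  open Renaming using (InjectiveBelow)
  open import Data.Nat using (zero; suc; _<_; s≤s)
  open import Data.List using (List; []; _∷_; length)
  open import Data.List.Relation.Unary.All as All using (All)
  open import Data.List.Relation.Unary.Any using (here; there)
  open import Data.List.Relation.Unary.AllPairs using (AllPairs; _∷_)
  open import Data.List.Membership.Propositional using (_∈_)
  open import Data.Empty using (⊥-elim)
  open import Relation.Binary.PropositionalEquality using (_≡_; _≢_; refl; sym; cong)

  -- The i-th name of a list (some default beyond its end).
  nameAt : List VName → ℕ → VName
  nameAt [] _ = V 0
  nameAt (a ∷ as) zero = a
  nameAt (a ∷ as) (suc i) = nameAt as i

  nameAt-∈ : ∀ as {i} → i < length as → nameAt as i ∈ as
  nameAt-∈ (a ∷ as) {zero} _ = here refl
  nameAt-∈ (a ∷ as) {suc i} (s≤s i<) = there (nameAt-∈ as i<)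

  nameAt-injective : ∀ {as} → AllPairs _≢_ as → ∀ i j → i < length as → j < length as →
                     nameAt as i ≡ nameAt as j → i ≡ j
  nameAt-injective _ zero zero _ _ _ = refl
  nameAt-injective {a ∷ as} (a∉as ∷ _) zero (suc j) _ (s≤s j<) a≡ = ⊥-elim (All.lookup a∉as (nameAt-∈ as j<) a≡)
  nameAt-injective {a ∷ as} (a∉as ∷ _) (suc i) zero (s≤s i<) _ ≡a = ⊥-elim (All.lookup a∉as (nameAt-∈ as i<) (sym ≡a))
  nameAt-injective (_ ∷ u) (suc i) (suc j) (s≤s i<) (s≤s j<) e = cong suc (nameAt-injective u i j i< j< e)

  naming : List VName → Var → Var
  naming as i = nm (nameAt as i)

  naming-injective : ∀ {as} → AllPairs _≢_ as → All (Relevant n) as → InjectiveBelow (naming as) (length as)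
  naming-injective u rel i j i< j< e =
    nameAt-injective u i j i< j< (dn _ _ (All.lookup rel (nameAt-∈ _ i<)) (All.lookup rel (nameAt-∈ _ j<)) e)

module Chain (m : ℕ) (nm : VName → Var) (dn : DistinctNames (3 + m) nm) where

  open Resolution
  open Renaming
  open Gadgets
  open Placement (3 + m) nm dn public
  open import Data.Nat using (zero; suc; _∸_; _*_; _≤_; _<_; s≤s; z≤n)
  open import Data.Nat.Properties using (≤-refl; <⇒≤; n≤1+n; ≤-trans; <⇒≱; m≤n⇒m<n∨m≡n; +-identityʳ; +-assoc; +-comm)
  open import Data.List using (List; []; _∷_; _++_; map; length; upTo)
  open import Data.List.Relation.Unary.All as All using (All; []; _∷_)
  import Data.List.Relation.Unary.All.Properties as Allₚ
  open import Data.List.Relation.Unary.Any as Any using (Any; here; there)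
  import Data.List.Relation.Unary.Any.Properties as Anyₚ
  import Data.List.Relation.Binary.Subset.Setoid.Properties as ⊆ₛ
  open import Data.List.Relation.Unary.AllPairs using (AllPairs; []; _∷_)
  import Data.List.Relation.Unary.AllPairs.Properties as AllPairsₚ
  open import Data.List.Membership.Propositional using (_∈_; find; lose)
  open import Data.List.Membership.Propositional.Properties
    using (∈-map⁺; ∈-map⁻; ∈-++⁺ˡ; ∈-++⁺ʳ; ∈-++⁻; ∈-concatMap⁺; ∈-concatMap⁻; ∈-upTo⁺; ∈-upTo⁻)
  open import Data.Product using (Σ; _×_; _,_; proj₁; proj₂)
  open import Data.Sum using (_⊎_; inj₁; inj₂)
  open import Relation.Nullary using (¬_)
  open import Relation.Binary.PropositionalEquality using (_≡_; refl; sym; trans; cong; cong₂; subst; module ≡-Reasoning)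
  open import Function using (_∘_)

  n : ℕ
  n = 3 + m

  T : ClauseSet
  T = Tn n nm

  Rel : VName → Set
  Rel = Relevant n

  -- The names placing the start, step k (for the index i = k + 3 < n) and the end.
  startNames finalNames : List VName
  startNames = V 1 ∷ V 2 ∷ Y 2 ∷ Y' 2 ∷ []
  finalNames = Y (2 + m) ∷ Y' (2 + m) ∷ V (3 + m) ∷ []

  stepNames : ℕ → List VName
  stepNames k = Y (2 + k) ∷ Y' (2 + k) ∷ V (3 + k) ∷ Y (3 + k) ∷ Y' (3 + k) ∷ []

  ρStart ρFinal : Var → Var
  ρStart = naming startNames
  ρFinal = naming finalNames

  ρStep : ℕ → Var → Var
  ρStep k = naming (stepNames k)

  3≤n : 3 ≤ n
  3≤n = s≤s (s≤s (s≤s z≤n))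

  startNames-relevant : All Rel startNames
  startNames-relevant = (s≤s z≤n , s≤s z≤n) ∷ (s≤s z≤n , s≤s (s≤s z≤n)) ∷
    (s≤s (s≤s z≤n) , s≤s (s≤s z≤n) , 3≤n) ∷ (s≤s (s≤s z≤n) , s≤s (s≤s z≤n) , 3≤n) ∷ []

  stepNames-relevant : ∀ {k} → k < m → All Rel (stepNames k)
  stepNames-relevant k<m =
    (s≤s (s≤s z≤n) , s≤s (s≤s (<⇒≤ k<m)) , 3≤n) ∷ (s≤s (s≤s z≤n) , s≤s (s≤s (<⇒≤ k<m)) , 3≤n) ∷
    (s≤s z≤n , s≤s (s≤s (s≤s (<⇒≤ k<m)))) ∷
    (s≤s (s≤s z≤n) , s≤s (s≤s k<m) , 3≤n) ∷ (s≤s (s≤s z≤n) , s≤s (s≤s k<m) , 3≤n) ∷ []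

  finalNames-relevant : All Rel finalNames
  finalNames-relevant = (s≤s (s≤s z≤n) , ≤-refl , 3≤n) ∷ (s≤s (s≤s z≤n) , ≤-refl , 3≤n) ∷ (s≤s z≤n , ≤-refl) ∷ []

  injective-start : InjectiveBelow ρStart 4
  injective-start = naming-injective
    (((λ ()) ∷ (λ ()) ∷ (λ ()) ∷ []) ∷ ((λ ()) ∷ (λ ()) ∷ []) ∷ ((λ ()) ∷ []) ∷ [] ∷ []) startNames-relevant

  injective-step : ∀ {k} → k < m → InjectiveBelow (ρStep k) 5
  injective-step k<m = naming-injective
    (((λ ()) ∷ (λ ()) ∷ (λ ()) ∷ (λ ()) ∷ []) ∷ ((λ ()) ∷ (λ ()) ∷ (λ ()) ∷ []) ∷
     ((λ ()) ∷ (λ ()) ∷ []) ∷ ((λ ()) ∷ []) ∷ [] ∷ []) (stepNames-relevant k<m)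

  injective-final : InjectiveBelow ρFinal 3
  injective-final = naming-injective (((λ ()) ∷ (λ ()) ∷ []) ∷ ((λ ()) ∷ []) ∷ [] ∷ []) finalNames-relevant

  xors : List Clause
  xors = TnXor n nm

  middle : List ℕ
  middle = map (3 +_) (upTo m)

  chainXor₁ chainXor₂ : ℕ → Clause
  chainXor₁ i = pos (nm (Y (i ∸ 1))) ∷ pos (nm (V i)) ∷ pos (nm (Y i)) ∷ []
  chainXor₂ i = pos (nm (Y' (i ∸ 1))) ∷ pos (nm (V i)) ∷ pos (nm (Y' i)) ∷ []

  3+k∈middle : ∀ {k} → k < m → 3 + k ∈ middle
  3+k∈middle k<m = ∈-map⁺ (3 +_) (∈-upTo⁺ k<m)

  gadget-axiom∈T : ∀ ρ {E₁ E₂ D} → ren ρ E₁ ∈ xors → ren ρ E₂ ∈ xors → D ∈ X0 E₁ ++ X0 E₂ → ren ρ D ∈ T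
  gadget-axiom∈T ρ {E₁} {E₂} E₁∈ E₂∈ D∈ with ∈-++⁻ (X0 E₁) D∈
  ... | inj₁ D∈₁ = ∈-concatMap⁺ X0 (lose E₁∈ (subst (_ ∈_) (sym (X0-ren ρ E₁)) (∈-map⁺ (ren ρ) D∈₁)))
  ... | inj₂ D∈₂ = ∈-concatMap⁺ X0 (lose E₂∈ (subst (_ ∈_) (sym (X0-ren ρ E₂)) (∈-map⁺ (ren ρ) D∈₂)))

  start∈T : ∀ {D} → D ∈ Start.axioms → ren ρStart D ∈ T
  start∈T = gadget-axiom∈T ρStart (here refl) (there (∈-++⁺ʳ (map chainXor₁ middle) (there (here refl))))

  step∈T : ∀ {k} → k < m → ∀ {D} → D ∈ Step.axioms → ren (ρStep k) D ∈ T
  step∈T k<m = gadget-axiom∈T (ρStep _)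
    (there (∈-++⁺ˡ (∈-map⁺ chainXor₁ (3+k∈middle k<m))))
    (there (∈-++⁺ʳ (map chainXor₁ middle) (there (there (∈-++⁺ˡ (∈-map⁺ chainXor₂ (3+k∈middle k<m)))))))

  final∈T : ∀ {D} → D ∈ Final.axioms → ren ρFinal D ∈ T
  final∈T = gadget-axiom∈T ρFinal
    (there (∈-++⁺ʳ (map chainXor₁ middle) (here refl)))
    (there (∈-++⁺ʳ (map chainXor₁ middle) (there (there (∈-++⁺ʳ (map chainXor₂ middle) (here refl))))))

  data Origin (D : Clause) : Set where
    start : ∀ {D'} → D' ∈ Start.axioms → D ≡ ren ρStart D' → Origin D
    step  : ∀ {k D'} → k < m → D' ∈ Step.axioms → D ≡ ren (ρStep k) D' → Origin D
    final : ∀ {D'} → D' ∈ Final.axioms → D ≡ ren ρFinal D' → Origin D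

  X0-ren⁻ : ∀ ρ E {D} → D ∈ X0 (ren ρ E) → Σ Clause λ D' → D' ∈ X0 E × D ≡ ren ρ D'
  X0-ren⁻ ρ E D∈ = ∈-map⁻ (ren ρ) (subst (_ ∈_) (X0-ren ρ E) D∈)

  origin : ∀ {D} → D ∈ T → Origin D
  origin D∈ with ∈-concatMap⁻ X0 {xs = xors} D∈
  ... | here D∈₁ with X0-ren⁻ ρStart Start.xor₁ D∈₁
  ...   | _ , D'∈ , refl = start (∈-++⁺ˡ D'∈) refl
  origin D∈ | there rest with Anyₚ.++⁻ (map chainXor₁ middle) rest
  ... | inj₁ inMiddle₁ with find (Anyₚ.map⁻ {xs = upTo m} (Anyₚ.map⁻ inMiddle₁))
  ...   | k , k∈ , D∈₁ with X0-ren⁻ (ρStep k) Step.xor₁ D∈₁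
  ...     | _ , D'∈ , refl = step (∈-upTo⁻ k∈) (∈-++⁺ˡ D'∈) refl
  origin D∈ | there rest | inj₂ (here D∈₁) with X0-ren⁻ ρFinal Final.xor₁ D∈₁
  ... | _ , D'∈ , refl = final (∈-++⁺ˡ D'∈) refl
  origin D∈ | there rest | inj₂ (there (here D∈₂)) with X0-ren⁻ ρStart Start.xor₂ D∈₂
  ... | _ , D'∈ , refl = start (∈-++⁺ʳ (X0 Start.xor₁) D'∈) refl
  origin D∈ | there rest | inj₂ (there (there rest₂)) with Anyₚ.++⁻ (map chainXor₂ middle) rest₂
  ... | inj₁ inMiddle₂ with find (Anyₚ.map⁻ {xs = upTo m} (Anyₚ.map⁻ inMiddle₂))
  ...   | k , k∈ , D∈₂ with X0-ren⁻ (ρStep k) Step.xor₂ D∈₂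
  ...     | _ , D'∈ , refl = step (∈-upTo⁻ k∈) (∈-++⁺ʳ (X0 Step.xor₁) D'∈) refl
  origin D∈ | there rest | inj₂ (there (there rest₂)) | inj₂ (here D∈₂) with X0-ren⁻ ρFinal Final.xor₂ D∈₂
  ... | _ , D'∈ , refl = final (∈-++⁺ʳ (X0 Final.xor₁) D'∈) refl

  -- The refutation: the start derives y₂ = y'₂ (link 0), step k turns link k,
  -- i.e. y_{k+2} = y'_{k+2}, into link (k + 1), and the end refutes link m.
  Link : ℕ → Set
  Link j = Deriv T (ren (ρStep j) link⁺) × Deriv T (ren (ρStep j) link⁻)

  module Linked {ρ K} (inj : InjectiveBelow ρ K) {axioms : ClauseSet}
                (hyps-bounded : All (Bounded K) (link⁺ ∷ link⁻ ∷ axioms))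
                (axioms∈T : ∀ {D} → D ∈ axioms → ren ρ D ∈ T)
                (d⁺ : Deriv T (ren ρ link⁺)) (d⁻ : Deriv T (ren ρ link⁻)) where

    hyp : ∀ {D} → D ∈ link⁺ ∷ link⁻ ∷ axioms → Deriv T (ren ρ D)
    hyp (here refl) = d⁺
    hyp (there (here refl)) = d⁻
    hyp (there (there D∈)) = axiom (axioms∈T D∈)

    open Transport inj hyps-bounded hyp public

    linkClauses : List Clause
    linkClauses = labels d⁺ ++ labels d⁻

    transport-⊆ : ∀ proofClauses → axioms ⊆ᶜ proofClauses → ∀ {C} (d : Deriv (link⁺ ∷ link⁻ ∷ axioms) C) →
                  labels d ⊆ᶜ proofClauses ++ link⁺ ∷ link⁻ ∷ [] →
                  labels (transport d) ⊆ᶜ map (ren ρ) proofClauses ++ linkClauses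
    transport-⊆ proofClauses axioms⊆ d d⊆ = ++-⊆ᶜ renamed⊆ ⊆ᶜ-refl ∘ labels-⊆ _ hyp⊆ d
      where
      links⊆ : map (ren ρ) (link⁺ ∷ link⁻ ∷ []) ⊆ᶜ linkClauses
      links⊆ = ++-⊆ᶜ (singleton-⊆ᶜ (∈⇒∈ᶜ (∈-++⁺ˡ (root∈labels d⁺))))
                     (singleton-⊆ᶜ (∈⇒∈ᶜ (∈-++⁺ʳ (labels d⁺) (root∈labels d⁻))))
      renamed⊆ : map (ren ρ) (labels d) ⊆ᶜ map (ren ρ) proofClauses ++ linkClauses
      renamed⊆ = ⊆ₛ.++⁺ clauseSetoid ⊆ᶜ-refl links⊆ ∘
                 map-ren-++ ρ proofClauses (link⁺ ∷ link⁻ ∷ []) ∘ map-ren-⊆ᶜ ρ d⊆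
      hyp⊆ : ∀ {D} (p : D ∈ link⁺ ∷ link⁻ ∷ axioms) → labels (hyp p) ⊆ᶜ map (ren ρ) proofClauses ++ linkClauses
      hyp⊆ (here refl) = ⊆ᶜ-++ʳ (map (ren ρ) proofClauses) (⊆ᶜ-++ˡ ⊆ᶜ-refl)
      hyp⊆ (there (here refl)) = ⊆ᶜ-++ʳ (map (ren ρ) proofClauses) (⊆ᶜ-++ʳ (labels d⁺) ⊆ᶜ-refl)
      hyp⊆ (there (there D∈)) = singleton-⊆ᶜ (⊆ᶜ-++ˡ (map-ren-⊆ᶜ ρ axioms⊆) (∈⇒∈ᶜ (∈-map⁺ (ren ρ) D∈)))

  module StartT = Transport injective-start Start.axioms-bounded (λ D∈ → axiom (start∈T D∈))

  module StepT {k} (k<m : k < m) (prev : Link k) =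
    Linked (injective-step k<m) Step.hypotheses-bounded (step∈T k<m) (proj₁ prev) (proj₂ prev)

  link : ∀ j → j ≤ m → Link j
  link zero _ = StartT.transport Start.derive⁺ , StartT.transport Start.derive⁻
  link (suc k) k<m = StepT.transport k<m prev Step.derive⁺ , StepT.transport k<m prev Step.derive⁻
    where prev : Link k
          prev = link k (<⇒≤ k<m)

  module FinalT = Linked injective-final Final.hypotheses-bounded final∈T
                         (proj₁ (link m ≤-refl)) (proj₂ (link m ≤-refl))

  refutation : Refutation T
  refutation = FinalT.transport Final.refutation

  idx : VName → ℕ
  idx (V i) = i
  idx (Y i) = i
  idx (Y' i) = i

  Below : ℕ → Clause → Set
  Below j C = All (λ l → Σ VName λ a → Rel a × idx a ≤ j × nm a ≡ var l) C

  Touches : ℕ → Clause → Set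
  Touches j C = Any (λ l → Σ VName λ a → Rel a × idx a ≡ j × nm a ≡ var l) C

  below-touches-≉ : ∀ {j j' C D} → Below j C → Touches j' D → j < j' → ¬ C ≐ D
  below-touches-≉ below touches j<j' (_ , D⊆C) with find touches
  ... | l , l∈D , (a , rel-a , idx-a , nm-a) with All.lookup below (All.lookup D⊆C l∈D)
  ...   | b , rel-b , idx-b , nm-b with dn a b rel-a rel-b (trans nm-a (sym nm-b))
  ...     | refl = <⇒≱ j<j' (subst (_≤ _) idx-a idx-b)

  below-mono : ∀ {j j' C} → j ≤ j' → Below j C → Below j' C
  below-mono j≤j' = All.map (λ { (a , rel , idx≤ , eq) → a , rel , ≤-trans idx≤ j≤j' , eq })

  below-ren : ∀ as j → All (λ a → Rel a × idx a ≤ j) as → ∀ {D} → Bounded (length as) D →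
              Below j (ren (naming as) D)
  below-ren as j low [] = []
  below-ren as j low {l ∷ D} (bl ∷ bD) =
    (nameAt as (var l) , proj₁ named , proj₂ named , sym (var-renL (naming as) l)) ∷ below-ren as j low bD
    where named : Rel (nameAt as (var l)) × idx (nameAt as (var l)) ≤ j
          named = All.lookup low (nameAt-∈ as bl)

  startNames-low : All (λ a → Rel a × idx a ≤ 2) startNames
  startNames-low = All.zip (startNames-relevant ,
    (s≤s z≤n ∷ s≤s (s≤s z≤n) ∷ ≤-refl ∷ ≤-refl ∷ []))

  stepNames-low : ∀ {k} → k < m → All (λ a → Rel a × idx a ≤ 3 + k) (stepNames k)
  stepNames-low {k} k<m = All.zip (stepNames-relevant k<m ,
    (n≤1+n (2 + k) ∷ n≤1+n (2 + k) ∷ ≤-refl ∷ ≤-refl ∷ ≤-refl ∷ []))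

  touches-step : ∀ {k} → k < m → ∀ {D} → Step.Fresh D → Touches (3 + k) (ren (ρStep k) D)
  touches-step {k} k<m fresh = Anyₚ.map⁺ (Any.map (λ {l} → named {l}) fresh)
    where
    named : ∀ {l} → 2 ≤ var l × var l < 5 → Σ VName λ a → Rel a × idx a ≡ 3 + k × nm a ≡ var (renL (ρStep k) l)
    named {l} (2≤ , <5) = nameAt (stepNames k) (var l) , All.lookup (stepNames-relevant k<m) (nameAt-∈ _ <5) ,
                          new-index (var l) 2≤ <5 , sym (var-renL (ρStep k) l)
      where
      new-index : ∀ a → 2 ≤ a → a < 5 → idx (nameAt (stepNames k) a) ≡ 3 + k
      new-index 0 () _
      new-index 1 (s≤s ()) _
      new-index 2 _ _ = refl
      new-index 3 _ _ = refl
      new-index 4 _ _ = refl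
      new-index (suc (suc (suc (suc (suc _))))) _ (s≤s (s≤s (s≤s (s≤s (s≤s ())))))

  touches-final : ∀ {D} → Any (λ l → var l ≡ 2) D → Touches (3 + m) (ren ρFinal D)
  touches-final mentions-vₙ = Anyₚ.map⁺ (Any.map (λ {l} → named {l}) mentions-vₙ)
    where
    named : ∀ {l} → var l ≡ 2 → Σ VName λ a → Rel a × idx a ≡ 3 + m × nm a ≡ var (renL ρFinal l)
    named {l} var≡2 = V (3 + m) , (s≤s z≤n , ≤-refl) , refl , trans (cong ρFinal (sym var≡2)) (sym (var-renL ρFinal l))

  -- Consecutive blocks are separated by
  -- levels, so the assembled list has no repetitions.
  module Blocks (first each : List Clause)
                (first-bounded : All (Bounded 4) first) (each-bounded : All (Bounded 5) each)
                (first-unique : Uniqueᶜ first) (each-unique : Uniqueᶜ each)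
                (each-fresh : All Step.Fresh each) where

    blocks : ℕ → List Clause
    blocks zero = map (ren ρStart) first
    blocks (suc k) = blocks k ++ map (ren (ρStep k)) each

    blocks-unique : ∀ j → j ≤ m → Uniqueᶜ (blocks j) × All (Below (2 + j)) (blocks j)
    blocks-unique zero _ =
      unique-ren injective-start first-bounded first-unique ,
      Allₚ.map⁺ (All.map (below-ren startNames 2 startNames-low) first-bounded)
    blocks-unique (suc k) k<m with blocks-unique k (<⇒≤ k<m)
    ... | unique-k , below-k =
      AllPairsₚ.++⁺ unique-k (unique-ren (injective-step k<m) each-bounded each-unique) separated ,
      Allₚ.++⁺ (All.map (below-mono (n≤1+n (2 + k))) below-k)
               (Allₚ.map⁺ (All.map (below-ren (stepNames k) (3 + k) (stepNames-low k<m)) each-bounded))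
      where
      separated : All (λ C → All (λ D → ¬ C ≐ D) (map (ren (ρStep k)) each)) (blocks k)
      separated = All.map (λ below-C → Allₚ.map⁺
        (All.map (λ fresh → below-touches-≉ below-C (touches-step k<m fresh) ≤-refl) each-fresh)) below-k

    Separated : Clause → Set
    Separated X = All (λ C → ¬ C ≐ X) (blocks m)

    blocks-unique-with : ∀ Xs → Uniqueᶜ Xs → All Separated Xs → Uniqueᶜ (blocks m ++ Xs)
    blocks-unique-with Xs unique-Xs separated =
      AllPairsₚ.++⁺ (proj₁ (blocks-unique m ≤-refl)) unique-Xs
        (All.tabulate (λ C∈ → All.map (λ sep-X → All.lookup sep-X C∈) separated))

    touching-separated : ∀ {X} → Touches (3 + m) X → Separated X
    touching-separated touches =
      All.map (λ below-C → below-touches-≉ below-C touches ≤-refl) (proj₂ (blocks-unique m ≤-refl))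

    fresh-separated : All (λ C → 2 ≤ len C) (blocks m) → ∀ {X} → Touches (3 + m) X ⊎ len X ≤ 1 → Separated X
    fresh-separated long (inj₁ touches) = touching-separated touches
    fresh-separated long (inj₂ short) = All.map (λ 2≤len C≐X → <⇒≱ 2≤len (subst (_≤ 1) (sym (len-≐ C≐X)) short)) long

    blocks-measure : (μ : List Clause → ℕ) → (∀ xs ys → μ (xs ++ ys) ≡ μ xs + μ ys) →
      μ (map (ren ρStart) first) ≡ μ first → (∀ {k} → k < m → μ (map (ren (ρStep k)) each) ≡ μ each) →
      ∀ j → j ≤ m → μ (blocks j) ≡ μ first + j * μ each
    blocks-measure μ additive μ-start μ-step zero _ = trans μ-start (sym (+-identityʳ _))
    blocks-measure μ additive μ-start μ-step (suc k) k<m = begin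
      μ (blocks k ++ map (ren (ρStep k)) each)         ≡⟨ additive (blocks k) _ ⟩
      μ (blocks k) + μ (map (ren (ρStep k)) each)
        ≡⟨ cong₂ _+_ (blocks-measure μ additive μ-start μ-step k (<⇒≤ k<m)) (μ-step k<m) ⟩
      μ first + k * μ each + μ each                    ≡⟨ +-assoc (μ first) _ _ ⟩
      μ first + (k * μ each + μ each)                  ≡⟨ cong (μ first +_) (+-comm (k * μ each) _) ⟩
      μ first + suc k * μ each                         ∎
      where open ≡-Reasoning

    blocks-All : (P : Clause → Set) → All (P ∘ ren ρStart) first → (∀ {k} → k < m → All (P ∘ ren (ρStep k)) each) →
                 ∀ j → j ≤ m → All P (blocks j)
    blocks-All P P-start P-step zero _ = Allₚ.map⁺ P-start
    blocks-All P P-start P-step (suc k) k<m = Allₚ.++⁺ (blocks-All P P-start P-step k (<⇒≤ k<m)) (Allₚ.map⁺ (P-step k<m))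

    blocks-mono : ∀ {j j'} → j ≤ j' → ∀ {C} → C ∈ blocks j → C ∈ blocks j'
    blocks-mono {j' = zero} z≤n C∈ = C∈
    blocks-mono {j' = suc j'} j≤ C∈ with m≤n⇒m<n∨m≡n j≤
    ... | inj₁ (s≤s j≤j') = ∈-++⁺ˡ (blocks-mono j≤j' C∈)
    ... | inj₂ refl = C∈

  module ProofBlocks = Blocks Start.proofClauses Step.proofClauses Start.proofClauses-bounded
    Step.proofClauses-bounded Start.proofClauses-unique Step.proofClauses-unique Step.proofClauses-fresh

  proofBlocks : ℕ → List Clause
  proofBlocks = ProofBlocks.blocks

  linkClauses : ∀ j → j ≤ m → List Clause
  linkClauses j j≤m = labels (proj₁ (link j j≤m)) ++ labels (proj₂ (link j j≤m))

  start-⊆ : ∀ {C} (d : Deriv Start.axioms C) → labels d ⊆ᶜ labels Start.derive⁺ ++ labels Start.derive⁻ →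
            labels (StartT.transport d) ⊆ᶜ map (ren ρStart) Start.proofClauses
  start-⊆ d d⊆ = ++-⊆ᶜ (map-ren-⊆ᶜ ρStart (Start.proofClauses-⊆ ∘ d⊆)) ⊆ᶜ-refl ∘ StartT.labels-⊆ _ axiom⊆ d
    where
    axiom⊆ : ∀ {D} (p : D ∈ Start.axioms) → ren ρStart D ∷ [] ⊆ᶜ map (ren ρStart) Start.proofClauses
    axiom⊆ p = singleton-⊆ᶜ (map-ren-⊆ᶜ ρStart Start.axioms-⊆ (∈⇒∈ᶜ (∈-map⁺ (ren ρStart) p)))

  link-⊆ : ∀ j (j≤m : j ≤ m) → linkClauses j j≤m ⊆ᶜ proofBlocks j
  link-⊆ zero _ = ++-⊆ᶜ (start-⊆ Start.derive⁺ (⊆ᶜ-++ˡ ⊆ᶜ-refl))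
                        (start-⊆ Start.derive⁻ (⊆ᶜ-++ʳ (labels Start.derive⁺) ⊆ᶜ-refl))
  link-⊆ (suc k) k<m =
    ++-⊆ᶜ (⊆ᶜ-++ʳ (proofBlocks k) ⊆ᶜ-refl) (⊆ᶜ-++ˡ (link-⊆ k (<⇒≤ k<m))) ∘
    ++-⊆ᶜ (StepT.transport-⊆ k<m prev Step.proofClauses Step.axioms-⊆ Step.derive⁺ (Step.proofClauses-⊆ ∘ ⊆ᶜ-++ˡ ⊆ᶜ-refl))
          (StepT.transport-⊆ k<m prev Step.proofClauses Step.axioms-⊆ Step.derive⁻
             (Step.proofClauses-⊆ ∘ ⊆ᶜ-++ʳ (labels Step.derive⁺) ⊆ᶜ-refl))
    where prev : Link k
          prev = link k (<⇒≤ k<m)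

  ⊆-link : ∀ j (j≤m : j ≤ m) → proofBlocks j ⊆ᶜ linkClauses j j≤m
  ⊆-link zero _ =
    ⊆ₛ.++⁺ clauseSetoid (StartT.labels-⊇ Start.derive⁺) (StartT.labels-⊇ Start.derive⁻) ∘
    map-ren-++ ρStart (labels Start.derive⁺) (labels Start.derive⁻) ∘ map-ren-⊆ᶜ ρStart Start.⊆-proofClauses
  ⊆-link (suc k) k<m =
    ++-⊆ᶜ (⊆ᶜ-++ˡ prev⊆ ∘ ⊆-link k (<⇒≤ k<m))
          (⊆ₛ.++⁺ clauseSetoid (StepT.labels-⊇ k<m prev Step.derive⁺) (StepT.labels-⊇ k<m prev Step.derive⁻) ∘
           map-ren-++ (ρStep k) (labels Step.derive⁺) (labels Step.derive⁻) ∘ map-ren-⊆ᶜ (ρStep k) Step.⊆-proofClauses)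
    where
    prev : Link k
    prev = link k (<⇒≤ k<m)
    -- derive⁺ uses the hypothesis link⁺ as its first leaf and link⁻ as its fourth.
    prev⊆ : linkClauses k (<⇒≤ k<m) ⊆ᶜ labels (StepT.transport k<m prev Step.derive⁺)
    prev⊆ = ++-⊆ᶜ (All.lookup (StepT.leaf-labels-⊆ k<m prev Step.derive⁺) (here refl))
                  (All.lookup (StepT.leaf-labels-⊆ k<m prev Step.derive⁺) (there (there (there (here refl)))))

  allProofClauses : List Clause
  allProofClauses = proofBlocks m ++ map (ren ρFinal) Final.proofClauses

  refutation-⊆ : labels refutation ⊆ᶜ allProofClauses
  refutation-⊆ =
    ++-⊆ᶜ (⊆ᶜ-++ʳ (proofBlocks m) ⊆ᶜ-refl) (⊆ᶜ-++ˡ (link-⊆ m ≤-refl)) ∘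
    FinalT.transport-⊆ Final.proofClauses Final.axioms-⊆ Final.refutation Final.proofClauses-⊆

  ⊆-refutation : allProofClauses ⊆ᶜ labels refutation
  ⊆-refutation = ++-⊆ᶜ (links⊆ ∘ ⊆-link m ≤-refl)
                       (FinalT.labels-⊇ Final.refutation ∘ map-ren-⊆ᶜ ρFinal Final.⊆-proofClauses)
    where
    -- The refutation uses the hypothesis link⁺ as its first leaf and link⁻ as its fifth.
    links⊆ : linkClauses m ≤-refl ⊆ᶜ labels refutation
    links⊆ = ++-⊆ᶜ (All.lookup (FinalT.leaf-labels-⊆ Final.refutation) (here refl))
                   (All.lookup (FinalT.leaf-labels-⊆ Final.refutation) (there (there (there (there (here refl))))))

module Measures (m : ℕ) (nm : VName → Var) (dn : DistinctNames (3 + m) nm) where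

  open Resolution
  open Renaming
  open Gadgets
  open Chain m nm dn
  open import Data.Nat using (zero; suc; _*_; _∸_; _≤_; _<_; s≤s; z≤n; _≟_)
  open import Data.Nat.Properties using (≤-refl; <⇒≤; m≤n⇒m<n∨m≡n; +-assoc; +-comm; *-comm; *-distribˡ-+; m+n∸m≡n)
  open import Data.List using (List; []; _∷_; _++_; map; length; concatMap)
  open import Data.List.Properties using (length-++; length-map; map-++)
  open import Data.List.Relation.Unary.All as All using (All; []; _∷_; all?)
  open import Data.List.Relation.Unary.Any using (here; there)
  open import Data.List.Relation.Unary.AllPairs as AllPairs using (AllPairs; []; _∷_)
  import Data.List.Relation.Unary.AllPairs.Properties as AllPairsₚ
  open import Relation.Nullary.Decidable using (from-yes)
  import Data.List.Relation.Unary.All.Properties as Allₚ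
  import Data.List.Relation.Binary.Subset.Setoid.Properties as ⊆ₛ
  open import Data.List.Membership.Propositional using (_∈_; find; lose)
  open import Relation.Binary.PropositionalEquality.Properties using (decSetoid)
  open import Data.List.Membership.Propositional.Properties
    using (∈-map⁺; ∈-map⁻; ∈-++⁺ˡ; ∈-++⁺ʳ; ∈-++⁻; ∈-concatMap⁺; ∈-concatMap⁻)
  open import Data.Product using (_×_; _,_; proj₁; proj₂)
  open import Data.Sum using (_⊎_; inj₁; inj₂)
  open import Function using (_∘_)
  open import Relation.Binary.PropositionalEquality using (_≡_; _≢_; refl; sym; trans; cong; cong₂; subst; module ≡-Reasoning)

  -- a(3 + m) − c = b + m·a + d whenever 3a = c + (b + d); this turns each count
  -- into the stated closed form.
  linear-form : ∀ a b c d → a * 3 ≡ c + (b + d) → a * (3 + m) ∸ c ≡ b + m * a + d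
  linear-form a b c d 3a≡ = begin
    a * (3 + m) ∸ c               ≡⟨ cong (_∸ c) expand ⟩
    c + (b + m * a + d) ∸ c       ≡⟨ m+n∸m≡n c _ ⟩
    b + m * a + d                 ∎
    where
    open ≡-Reasoning
    expand : a * (3 + m) ≡ c + (b + m * a + d)
    expand = begin
      a * (3 + m)                 ≡⟨ *-distribˡ-+ a 3 m ⟩
      a * 3 + a * m               ≡⟨ cong₂ _+_ 3a≡ (*-comm a m) ⟩
      c + (b + d) + m * a         ≡⟨ +-assoc c (b + d) (m * a) ⟩
      c + (b + d + m * a)         ≡⟨ cong (c +_) (+-assoc b d (m * a)) ⟩
      c + (b + (d + m * a))       ≡⟨ cong (λ x → c + (b + x)) (+-comm d (m * a)) ⟩
      c + (b + (m * a + d))       ≡⟨ cong (c +_) (sym (+-assoc b (m * a) d)) ⟩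
      c + (b + m * a + d)         ∎

  T-All : (P : Clause → Set) → All (P ∘ ren ρStart) Start.axioms →
          (∀ {k} → k < m → All (P ∘ ren (ρStep k)) Step.axioms) → All (P ∘ ren ρFinal) Final.axioms → All P T
  T-All P P-start P-step P-final = All.tabulate (λ D∈ → from-origin (origin D∈))
    where
    from-origin : ∀ {D} → Origin D → P D
    from-origin (start D'∈ refl) = All.lookup P-start D'∈
    from-origin (step k<m D'∈ refl) = All.lookup (P-step k<m) D'∈
    from-origin (final D'∈ refl) = All.lookup P-final D'∈

  T-nonTaut : All NonTaut T
  T-nonTaut = T-All NonTaut (nonTaut-ren injective-start Start.axioms-bounded Start.axioms-nonTaut)
    (λ k<m → nonTaut-ren (injective-step k<m) Step.axioms-bounded Step.axioms-nonTaut)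
    (nonTaut-ren injective-final Final.axioms-bounded Final.axioms-nonTaut)

  T-unsat : Unsatisfiable T
  T-unsat = Soundness.refutation⇒unsat T-nonTaut refutation

  T-lengths : All (λ C → len C ≤ 3) T
  T-lengths = T-All (λ C → len C ≤ 3) (short injective-start Start.axioms-bounded Start.axioms-lengths)
    (λ k<m → short (injective-step k<m) Step.axioms-bounded Step.axioms-lengths)
    (short injective-final Final.axioms-bounded Final.axioms-lengths)
    where
    short : ∀ {ρ K} → InjectiveBelow ρ K → ∀ {Cs} → All (Bounded K) Cs → All (LengthIn 2 3) Cs →
            All (λ C → len (ren ρ C) ≤ 3) Cs
    short inj bCs lengths = lengths-ren {λ l → l ≤ 3} inj bCs (All.map proj₂ lengths)

  proofBlocks-lengths : All (LengthIn 2 3) (proofBlocks m)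
  proofBlocks-lengths = ProofBlocks.blocks-All (LengthIn 2 3)
    (lengths-ren {λ l → 2 ≤ l × l ≤ 3} injective-start Start.proofClauses-bounded Start.proofClauses-lengths)
    (λ k<m → lengths-ren {λ l → 2 ≤ l × l ≤ 3} (injective-step k<m) Step.proofClauses-bounded Step.proofClauses-lengths)
    m ≤-refl

  -- Renamed final clauses touch level n or are too short to occur in the blocks.
  final-fresh : ∀ {Cs} → All (Bounded 3) Cs → All Final.Fresh Cs →
                All (λ C → Touches (3 + m) (ren ρFinal C) ⊎ len (ren ρFinal C) ≤ 1) Cs
  final-fresh bCs fresh = All.zipWith renamed (bCs , fresh)
    where
    renamed : ∀ {C} → Bounded 3 C × Final.Fresh C → Touches (3 + m) (ren ρFinal C) ⊎ len (ren ρFinal C) ≤ 1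
    renamed (_ , inj₁ mentions-vₙ) = inj₁ (touches-final mentions-vₙ)
    renamed (bC , inj₂ short) = inj₂ (subst (_≤ 1) (sym (len-ren injective-final bC)) short)

  allProofClauses-unique : Uniqueᶜ allProofClauses
  allProofClauses-unique = ProofBlocks.blocks-unique-with _
    (unique-ren injective-final Final.proofClauses-bounded Final.proofClauses-unique)
    (Allₚ.map⁺ (All.map (ProofBlocks.fresh-separated (All.map proj₁ proofBlocks-lengths))
                        (final-fresh Final.proofClauses-bounded Final.proofClauses-fresh)))

  refutation-count : numClauses refutation ≡ 18 * (3 + m) ∸ 29
  refutation-count = begin
    length (ClauseD.distinct (labels refutation))                   ≡⟨ ClauseD.count-distinct-cong refutation-⊆ ⊆-refutation ⟩
    length (ClauseD.distinct allProofClauses)                       ≡⟨ ClauseD.count-unique allProofClauses-unique ⟩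
    length allProofClauses                                          ≡⟨ length-++ (proofBlocks m) ⟩
    length (proofBlocks m) + length (map (ren ρFinal) Final.proofClauses)
      ≡⟨ cong₂ _+_ (ProofBlocks.blocks-measure length (λ xs _ → length-++ xs) (length-map (ren ρStart) Start.proofClauses)
                                                   (λ {k} _ → length-map (ren (ρStep k)) Step.proofClauses) m ≤-refl)
                   (length-map (ren ρFinal) Final.proofClauses) ⟩
    14 + m * 18 + 11                                                ≡⟨ sym (linear-form 18 14 29 11 refl) ⟩
    18 * (3 + m) ∸ 29                                               ∎
    where open ≡-Reasoning

  refutation-width : WidthBound 3 refutation
  refutation-width = ⊆ₛ.All-resp-⊇ clauseSetoid {P = λ C → len C ≤ 3}
    (λ C≐D l≤3 → subst (_≤ 3) (len-≐ C≐D) l≤3) refutation-⊆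
    (Allₚ.++⁺ (All.map proj₂ proofBlocks-lengths)
              (Allₚ.map⁺ {f = ren ρFinal} (lengths-ren {_≤ 3} injective-final Final.proofClauses-bounded
                                                         (All.map proj₂ Final.proofClauses-lengths))))

  module AxiomBlocks = Blocks Start.axioms Step.axioms Start.axioms-bounded Step.axioms-bounded
    Start.axioms-unique Step.axioms-unique Step.axioms-fresh

  allAxioms : List Clause
  allAxioms = AxiomBlocks.blocks m ++ map (ren ρFinal) Final.axioms

  T-⊆ : T ⊆ᶜ allAxioms
  T-⊆ = ⊆⇒⊆ᶜ (λ D∈ → from-origin (origin D∈))
    where
    from-origin : ∀ {D} → Origin D → D ∈ allAxioms
    from-origin (start D'∈ refl) = ∈-++⁺ˡ (AxiomBlocks.blocks-mono {j' = m} z≤n (∈-map⁺ (ren ρStart) D'∈))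
    from-origin (step {k} k<m D'∈ refl) =
      ∈-++⁺ˡ (AxiomBlocks.blocks-mono {j' = m} k<m (∈-++⁺ʳ (AxiomBlocks.blocks k) (∈-map⁺ (ren (ρStep k)) D'∈)))
    from-origin (final D'∈ refl) = ∈-++⁺ʳ (AxiomBlocks.blocks m) (∈-map⁺ (ren ρFinal) D'∈)

  ⊆-T : allAxioms ⊆ᶜ T
  ⊆-T = ⊆⇒⊆ᶜ (All.lookup (Allₚ.++⁺
    (AxiomBlocks.blocks-All (_∈ T) (All.tabulate start∈T) (λ k<m → All.tabulate (step∈T k<m)) m ≤-refl)
    (Allₚ.map⁺ (All.tabulate final∈T))))

  allAxioms-unique : Uniqueᶜ allAxioms
  allAxioms-unique = AxiomBlocks.blocks-unique-with _
    (unique-ren injective-final Final.axioms-bounded Final.axioms-unique)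
    (Allₚ.map⁺ (All.map (AxiomBlocks.fresh-separated long) (final-fresh Final.axioms-bounded Final.axioms-fresh)))
    where
    long : All (λ C → 2 ≤ len C) (AxiomBlocks.blocks m)
    long = AxiomBlocks.blocks-All (λ C → 2 ≤ len C)
      (lengths-ren {2 ≤_} injective-start Start.axioms-bounded (All.map proj₁ Start.axioms-lengths))
      (λ k<m → lengths-ren {2 ≤_} (injective-step k<m) Step.axioms-bounded (All.map proj₁ Step.axioms-lengths))
      m ≤-refl

  T-clauses : cF T ≡ 8 * (3 + m) ∸ 12
  T-clauses = begin
    length (ClauseD.distinct T)                                     ≡⟨ ClauseD.count-distinct-cong T-⊆ ⊆-T ⟩
    length (ClauseD.distinct allAxioms)                             ≡⟨ ClauseD.count-unique allAxioms-unique ⟩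
    length allAxioms                                                ≡⟨ length-++ (AxiomBlocks.blocks m) ⟩
    length (AxiomBlocks.blocks m) + length (map (ren ρFinal) Final.axioms)
      ≡⟨ cong₂ _+_ (AxiomBlocks.blocks-measure length (λ xs _ → length-++ xs) (length-map (ren ρStart) Start.axioms)
                                                   (λ {k} _ → length-map (ren (ρStep k)) Step.axioms) m ≤-refl)
                   (length-map (ren ρFinal) Final.axioms) ⟩
    8 + m * 8 + 4                                                   ≡⟨ sym (linear-form 8 8 12 4 refl) ⟩
    8 * (3 + m) ∸ 12                                                ∎
    where open ≡-Reasoning

  T-literals : ℓF T ≡ 24 * (3 + m) ∸ 40
  T-literals = begin
    Σlen (ClauseD.distinct T)                                       ≡⟨ ClauseD.sum-distinct-cong len-≐ T-⊆ ⊆-T ⟩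
    Σlen (ClauseD.distinct allAxioms)                               ≡⟨ ClauseD.sum-distinct-unique allAxioms-unique ⟩
    Σlen allAxioms                                                  ≡⟨ Σlen-++ (AxiomBlocks.blocks m) _ ⟩
    Σlen (AxiomBlocks.blocks m) + Σlen (map (ren ρFinal) Final.axioms)
      ≡⟨ cong₂ _+_ (AxiomBlocks.blocks-measure Σlen Σlen-++ (Σlen-ren injective-start Start.axioms-bounded)
                                                   (λ k<m → Σlen-ren (injective-step k<m) Step.axioms-bounded) m ≤-refl)
                   (Σlen-ren injective-final Final.axioms-bounded) ⟩
    24 + m * 24 + 8                                                 ≡⟨ sym (linear-form 24 24 40 8 refl) ⟩
    24 * (3 + m) ∸ 40                                               ∎
    where open ≡-Reasoning

  -- Variables are counted through unit clauses: x ↦ [x] turns the chain of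
  -- variables into blocks of unit clauses, separated by levels like clauses.
  unit : Var → Clause
  unit x = pos x ∷ []

  startVars stepVars : List Var
  startVars = 0 ∷ 1 ∷ 2 ∷ 3 ∷ []
  stepVars = 2 ∷ 3 ∷ 4 ∷ []

  module UnitBlocks = Blocks (map unit startVars) (map unit stepVars)
    (from-yes (bounded? 4 (map unit startVars))) (from-yes (bounded? 5 (map unit stepVars)))
    (from-yes (uniqueᶜ? (map unit startVars))) (from-yes (uniqueᶜ? (map unit stepVars)))
    (from-yes (all? Step.fresh? (map unit stepVars)))

  chainVariables : ℕ → List Var
  chainVariables zero = map ρStart startVars
  chainVariables (suc k) = chainVariables k ++ map (ρStep k) stepVars

  allVariables : List Var
  allVariables = chainVariables m ++ ρFinal 2 ∷ []

  units-chainVariables : ∀ j → map unit (chainVariables j) ≡ UnitBlocks.blocks j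
  units-chainVariables zero = refl
  units-chainVariables (suc k) =
    trans (map-++ unit (chainVariables k) _) (cong (_++ map (ren (ρStep k)) (map unit stepVars)) (units-chainVariables k))

  allVariables-unique : AllPairs _≢_ allVariables
  allVariables-unique = AllPairs.map (λ unit≉ x≡y → unit≉ (subst (λ y → unit _ ≐ unit y) x≡y ≐-refl))
    (AllPairsₚ.map⁻ (subst Uniqueᶜ (sym units-all) unique-units))
    where
    units-all : map unit allVariables ≡ UnitBlocks.blocks m ++ unit (ρFinal 2) ∷ []
    units-all = trans (map-++ unit (chainVariables m) _) (cong (_++ unit (ρFinal 2) ∷ []) (units-chainVariables m))
    unique-units : Uniqueᶜ (UnitBlocks.blocks m ++ unit (ρFinal 2) ∷ [])
    unique-units = UnitBlocks.blocks-unique-with _ ([] ∷ [])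
      (UnitBlocks.touching-separated (here (V (3 + m) , (s≤s z≤n , ≤-refl) , refl , refl)) ∷ [])

  chainVariables-mono : ∀ {j j'} → j ≤ j' → ∀ {x} → x ∈ chainVariables j → x ∈ chainVariables j'
  chainVariables-mono {j' = zero} z≤n x∈ = x∈
  chainVariables-mono {j' = suc j'} j≤ x∈ with m≤n⇒m<n∨m≡n j≤
  ... | inj₁ (s≤s j≤j') = ∈-++⁺ˡ (chainVariables-mono j≤j' x∈)
  ... | inj₂ refl = x∈

  link-variables : ∀ j → (nm (Y (2 + j)) ∈ chainVariables j) × (nm (Y' (2 + j)) ∈ chainVariables j)
  link-variables zero = there (there (here refl)) , there (there (there (here refl)))
  link-variables (suc k) = ∈-++⁺ʳ (chainVariables k) (there (here refl)) ,
                           ∈-++⁺ʳ (chainVariables k) (there (there (here refl)))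

  start-var : ∀ {a} → a < 4 → ρStart a ∈ allVariables
  start-var a<4 = ∈-++⁺ˡ (chainVariables-mono {j' = m} z≤n (∈-map⁺ ρStart (position a<4)))
    where
    position : ∀ {a} → a < 4 → a ∈ startVars
    position {0} _ = here refl
    position {1} _ = there (here refl)
    position {2} _ = there (there (here refl))
    position {3} _ = there (there (there (here refl)))
    position {suc (suc (suc (suc _)))} (s≤s (s≤s (s≤s (s≤s ()))))

  step-var : ∀ {k} → k < m → ∀ {a} → a < 5 → ρStep k a ∈ allVariables
  step-var {k} k<m {a} a<5 = ∈-++⁺ˡ (position a a<5)
    where
    introduced : ∀ {x} → x ∈ map (ρStep k) stepVars → x ∈ chainVariables m
    introduced x∈ = chainVariables-mono k<m (∈-++⁺ʳ (chainVariables k) x∈)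
    position : ∀ a → a < 5 → ρStep k a ∈ chainVariables m
    position 0 _ = chainVariables-mono (<⇒≤ k<m) (proj₁ (link-variables k))
    position 1 _ = chainVariables-mono (<⇒≤ k<m) (proj₂ (link-variables k))
    position 2 _ = introduced (here refl)
    position 3 _ = introduced (there (here refl))
    position 4 _ = introduced (there (there (here refl)))
    position (suc (suc (suc (suc (suc _))))) (s≤s (s≤s (s≤s (s≤s (s≤s ())))))

  final-var : ∀ {a} → a < 3 → ρFinal a ∈ allVariables
  final-var {0} _ = ∈-++⁺ˡ (proj₁ (link-variables m))
  final-var {1} _ = ∈-++⁺ˡ (proj₂ (link-variables m))
  final-var {2} _ = ∈-++⁺ʳ (chainVariables m) (here refl)
  final-var {suc (suc (suc _))} (s≤s (s≤s (s≤s ())))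

  gadget-var : ∀ {ρ K axioms} → (∀ {a} → a < K → ρ a ∈ allVariables) → All (Bounded K) axioms →
               ∀ {D x} → D ∈ axioms → x ∈ map var (ren ρ D) → x ∈ allVariables
  gadget-var {ρ} named bounded {D} D∈ x∈ with ∈-map⁻ var x∈
  ... | l , l∈ , refl with ∈-ren⁻ D l∈
  ...   | l' , l'∈D , refl = subst (_∈ allVariables) (sym (var-renL ρ l'))
                                   (named (All.lookup (All.lookup bounded D∈) l'∈D))

  variables : ClauseSet → List Var
  variables F = concatMap (map var) F

  T-variables-⊆ : ∀ {x} → x ∈ variables T → x ∈ allVariables
  T-variables-⊆ x∈ with find (∈-concatMap⁻ (map var) {xs = T} x∈)
  ... | D , D∈ , x∈D with origin D∈
  ...   | start D'∈ refl = gadget-var start-var Start.axioms-bounded D'∈ x∈D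
  ...   | step k<m D'∈ refl = gadget-var (step-var k<m) Step.axioms-bounded D'∈ x∈D
  ...   | final D'∈ refl = gadget-var final-var Final.axioms-bounded D'∈ x∈D

  occurs-ren : ∀ {ρ F} → (∀ {D} → D ∈ F → ren ρ D ∈ T) → ∀ {a} → Occurs F a → ρ a ∈ variables T
  occurs-ren {ρ} cover occurs with find occurs
  ... | D , D∈F , occurs-D with find occurs-D
  ...   | l , l∈D , refl = ∈-concatMap⁺ (map var) (lose (cover D∈F)
            (subst (_∈ map var (ren ρ D)) (var-renL ρ l) (∈-map⁺ var (∈-ren⁺ l∈D))))

  allVariables-⊆ : ∀ {x} → x ∈ allVariables → x ∈ variables T
  allVariables-⊆ x∈ with ∈-++⁻ (chainVariables m) x∈
  ... | inj₁ x∈chain = chain m ≤-refl x∈chain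
    where
    chain : ∀ j → j ≤ m → ∀ {x} → x ∈ chainVariables j → x ∈ variables T
    chain zero _ x∈ with ∈-map⁻ ρStart x∈
    ... | a , a∈ , refl = occurs-ren start∈T (All.lookup Start.axioms-variables a∈)
    chain (suc k) k<m x∈ with ∈-++⁻ (chainVariables k) x∈
    ... | inj₁ x∈k = chain k (<⇒≤ k<m) x∈k
    ... | inj₂ x∈new with ∈-map⁻ (ρStep k) x∈new
    ...   | a , a∈ , refl = occurs-ren (step∈T k<m) (All.lookup Step.axioms-variables a∈)
  ... | inj₂ (here refl) = occurs-ren final∈T (All.lookup Final.axioms-variables (here refl))

  module VarD = Distinct (decSetoid _≟_)

  T-variables : nF T ≡ 3 * (3 + m) ∸ 4
  T-variables = begin
    length (VarD.distinct (variables T))        ≡⟨ VarD.count-distinct-cong T-variables-⊆ allVariables-⊆ ⟩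
    length (VarD.distinct allVariables)         ≡⟨ VarD.count-unique allVariables-unique ⟩
    length allVariables                         ≡⟨ length-++ (chainVariables m) ⟩
    length (chainVariables m) + 1               ≡⟨ cong (_+ 1) chain-length ⟩
    4 + m * 3 + 1                               ≡⟨ sym (linear-form 3 4 4 1 refl) ⟩
    3 * (3 + m) ∸ 4                             ∎
    where
    open ≡-Reasoning
    chain-length : length (chainVariables m) ≡ 4 + m * 3
    chain-length = begin
      length (chainVariables m)                 ≡⟨ sym (length-map unit (chainVariables m)) ⟩
      length (map unit (chainVariables m))      ≡⟨ cong length (units-chainVariables m) ⟩
      length (UnitBlocks.blocks m)
        ≡⟨ UnitBlocks.blocks-measure length (λ xs _ → length-++ xs) refl (λ _ → refl) m ≤-refl ⟩
      4 + m * 3                                 ∎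

module LowerBound (m : ℕ) (nm : VName → Var) (dn : DistinctNames (3 + m) nm) where

  open Resolution
  open Renaming
  open Gadgets
  open Chain m nm dn
  open import Data.Nat using (suc; _≤_; _<_; _≟_; s≤s; z≤n)
  open import Data.Nat.Properties using (<⇒≢; +-cancelˡ-≡; <⇒≱; ≤-pred)
  open import Data.Bool using (Bool; true; false; not)
  open import Data.List using (List; []; _∷_)
  open import Data.List.Relation.Unary.All as All using (All; []; _∷_)
  import Data.List.Relation.Unary.All.Properties as Allₚ
  open import Data.List.Relation.Unary.Any using (here; there)
  open import Data.List.Membership.Propositional using (_∈_; find; lose)
  open import Data.List.Membership.Propositional.Properties using (∈-++⁺ˡ; ∈-++⁺ʳ; ∈-++⁻)
  open import Data.Product using (Σ; _×_; _,_; proj₁; proj₂)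
  open import Data.Sum using (_⊎_; inj₁; inj₂)
  open import Data.Empty using (⊥-elim)
  open import Function using (_∘_; case_of_)
  open import Relation.Nullary using (¬_; yes; no)
  open import Relation.Binary.PropositionalEquality using (_≡_; _≢_; refl; sym; trans; cong; subst)

  -- K: the three variables y_{n-1}, y'_{n-1}, vₙ of the end gadget.
  InK : Var → Set
  InK x = Σ ℕ λ a → a < 3 × ρFinal a ≡ x

  -- φ b sets y_{n-1} = vₙ = b and y'_{n-1} = ¬b, like Final.ψ b on the local
  -- variables; its values elsewhere play no role.
  φ : Bool → Assignment
  φ b x with x ≟ ρFinal 0 | x ≟ ρFinal 1
  ... | yes _ | _ = b
  ... | no _ | yes _ = not b
  ... | no _ | no _ = b

  final-distinct : ∀ {a b} → a < 3 → b < 3 → a ≢ b → ρFinal a ≢ ρFinal b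
  final-distinct a<3 b<3 a≢b e = a≢b (injective-final _ _ a<3 b<3 e)

  φ-final : ∀ b a → a < 3 → Final.ψ b a ≡ φ b (ρFinal a)
  φ-final b 0 _ with ρFinal 0 ≟ ρFinal 0
  ... | yes _ = refl
  ... | no ≢ = ⊥-elim (≢ refl)
  φ-final b 1 1<3 with ρFinal 1 ≟ ρFinal 0 | ρFinal 1 ≟ ρFinal 1
  ... | yes e | _ = ⊥-elim (final-distinct 1<3 (s≤s z≤n) (λ ()) e)
  ... | no _ | yes _ = refl
  ... | no _ | no ≢ = ⊥-elim (≢ refl)
  φ-final b 2 2<3 with ρFinal 2 ≟ ρFinal 0 | ρFinal 2 ≟ ρFinal 1
  ... | yes e | _ = ⊥-elim (final-distinct 2<3 (s≤s z≤n) (λ ()) e)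
  ... | no _ | yes e = ⊥-elim (final-distinct 2<3 (s≤s (s≤s z≤n)) (λ ()) e)
  ... | no _ | no _ = refl
  φ-final b (suc (suc (suc _))) (s≤s (s≤s (s≤s ())))

  φ-flip : ∀ {x} → InK x → φ true x ≡ not (φ false x)
  φ-flip (a , a<3 , refl) rewrite sym (φ-final true a a<3) | sym (φ-final false a a<3) = flip a
    where
    flip : ∀ a → Final.ψ true a ≡ not (Final.ψ false a)
    flip 0 = refl
    flip 1 = refl
    flip (suc (suc _)) = refl

  literal-flip : ∀ l → InK (var l) → litVal (φ true) l ≡ not (litVal (φ false) l)
  literal-flip (pos x) x∈K = φ-flip x∈K
  literal-flip (neg x) x∈K = cong not (φ-flip x∈K)

  falsified : ∀ l → InK (var l) → Σ Bool λ b → litVal (φ b) l ≡ false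
  falsified l l∈K with litVal (φ false) l in eq
  ... | false = false , eq
  ... | true = true , trans (literal-flip l l∈K) (cong not eq)

  -- The invariant of hardness-2 derivations from T: every derived clause is
  -- either over K and true under both φ b, or wide: at least three literals,
  -- two of them outside K, and at most one over K.
  record OverK (C : Clause) : Set where
    field
      nonTaut : NonTaut C
      inK     : All (InK ∘ var) C
      sat     : ∀ b → SatClause (φ b) C

  AtMostOneK : Clause → Set
  AtMostOneK C = ∀ l l' → l ∈ C → l' ∈ C → InK (var l) → InK (var l') → l ≡ l'

  record Wide (C : Clause) : Set where
    field
      nonTaut : NonTaut C
      long    : 3 ≤ len C
      a b     : Lit
      a∈      : a ∈ C
      b∈      : b ∈ C
      a≢b     : a ≢ b
      a∉K     : ¬ InK (var a)
      b∉K     : ¬ InK (var b)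
      oneK    : AtMostOneK C

  Inv : Clause → Set
  Inv C = OverK C ⊎ Wide C

  OverK-≐ : ∀ {C D} → C ≐ D → OverK D → OverK C
  OverK-≐ C≐D overK = record
    { nonTaut = NonTaut-≐ C≐D nonTaut
    ; inK = All.map (All.lookup inK) (proj₁ C≐D)
    ; sat = λ b → let (l , l∈D , true-l) = find (sat b) in lose (All.lookup (proj₂ C≐D) l∈D) true-l }
    where open OverK overK

  Wide-≐ : ∀ {C D} → C ≐ D → Wide D → Wide C
  Wide-≐ C≐D wide = record
    { nonTaut = NonTaut-≐ C≐D nonTaut ; long = subst (3 ≤_) (sym (len-≐ C≐D)) long
    ; a = a ; b = b ; a∈ = D⊆C a∈ ; b∈ = D⊆C b∈ ; a≢b = a≢b ; a∉K = a∉K ; b∉K = b∉K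
    ; oneK = λ l l' l∈ l'∈ → oneK l l' (≐-∈ C≐D l∈) (≐-∈ C≐D l'∈) }
    where
    open Wide wide
    D⊆C : ∀ {l} → l ∈ _ → l ∈ _
    D⊆C = All.lookup (proj₂ C≐D)

  outside-≢ : ∀ {l k} → ¬ InK (var l) → InK (var k) → l ≢ k
  outside-≢ l∉K k∈K refl = l∉K k∈K

  overK-resolvent : ∀ {C D x} → OverK C → OverK D → Clash C D x → OverK (resolvent C D x)
  overK-resolvent {C} {D} {x} oC oD clash = record
    { nonTaut = NonTaut-resolvent (OverK.nonTaut oC) (OverK.nonTaut oD) clash
    ; inK = All.tabulate inK
    ; sat = λ b → sat-resolvent (φ b) (OverK.nonTaut oC) (OverK.nonTaut oD) clash ≐-refl (OverK.sat oC b) (OverK.sat oD b) }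
    where
    inK : ∀ {l} → l ∈ resolvent C D x → InK (var l)
    inK l∈ with ∈-++⁻ C (proj₁ (∈-resolvent⁻ {C} {D} l∈))
    ... | inj₁ l∈C = All.lookup (OverK.inK oC) l∈C
    ... | inj₂ l∈D = All.lookup (OverK.inK oD) l∈D

  -- In a clause over K true under both φ b, the literal x is false under some
  -- φ b, which then makes another literal c true; c is neither x nor x̄.
  other-literal : ∀ {P x} → OverK P → x ∈ P → Σ Lit λ c → c ∈ P × c ≢ x × c ≢ compl x
  other-literal {P} {x} overK x∈P with falsified x (All.lookup (OverK.inK overK) x∈P)
  ... | b , x-false with find (OverK.sat overK b)
  ...   | c , c∈P , c-true =
    c , c∈P , (λ c≡x → case trans (sym c-true) (trans (cong (litVal (φ b)) c≡x) x-false) of λ ())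
      , (λ c≡x̄ → OverK.nonTaut overK x x∈P (subst (_∈ P) c≡x̄ c∈P))

  -- The two outside literals of the wide
  -- parent survive, the short parent contributes its other literal, and a
  -- second K-literal would give the short parent three literals.
  short-wide : ∀ {P Q x} → OverK P → len P ≤ 2 → Wide Q → Clash P Q x → Wide (resolvent P Q x)
  short-wide {P} {Q} {x} overK short wide clash@(x∈P , x̄∈Q , _) with other-literal overK x∈P
  ... | c , c∈P , c≢x , c≢x̄ = record
    { nonTaut = NonTaut-resolvent (OverK.nonTaut overK) (Wide.nonTaut wide) clash
    ; long = three≤len a∈R b∈R c∈R a≢b (outside-≢ a∉K c∈K) (outside-≢ b∉K c∈K)
    ; a = a ; b = b ; a∈ = a∈R ; b∈ = b∈R ; a≢b = a≢b ; a∉K = a∉K ; b∉K = b∉K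
    ; oneK = oneK-R }
    where
    open Wide wide using (a; b; a≢b; a∉K; b∉K)
    x∈K : InK (var x)
    x∈K = All.lookup (OverK.inK overK) x∈P
    x̄∈K : InK (var (compl x))
    x̄∈K = subst InK (sym (var-compl x)) x∈K
    from-Q : ∀ {l} → l ∈ Q → ¬ InK (var l) → l ∈ resolvent P Q x
    from-Q l∈Q l∉K = ∈-resolvent⁺ {P} {Q} (∈-++⁺ʳ P l∈Q) (outside-≢ l∉K x∈K) (outside-≢ l∉K x̄∈K)
    a∈R : a ∈ resolvent P Q x
    a∈R = from-Q (Wide.a∈ wide) a∉K
    b∈R : b ∈ resolvent P Q x
    b∈R = from-Q (Wide.b∈ wide) b∉K
    c∈K : InK (var c)
    c∈K = All.lookup (OverK.inK overK) c∈P
    c∈R : c ∈ resolvent P Q x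
    c∈R = ∈-resolvent⁺ {P} {Q} (∈-++⁺ˡ c∈P) c≢x c≢x̄
    -- K-literals of the resolvent come from P, since x̄ is the only K-literal of Q.
    K-from-P : ∀ {l} → l ∈ resolvent P Q x → InK (var l) → l ∈ P × l ≢ x
    K-from-P l∈ l∈K with ∈-resolvent⁻ {P} {Q} l∈
    ... | l∈PQ , l≢x , l≢x̄ with ∈-++⁻ P l∈PQ
    ...   | inj₁ l∈P = l∈P , l≢x
    ...   | inj₂ l∈Q = ⊥-elim (l≢x̄ (Wide.oneK wide _ _ l∈Q x̄∈Q l∈K x̄∈K))
    oneK-R : AtMostOneK (resolvent P Q x)
    oneK-R l l' l∈ l'∈ l∈K l'∈K with l ≟L l' | K-from-P l∈ l∈K | K-from-P l'∈ l'∈K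
    ... | yes l≡l' | _ | _ = l≡l'
    ... | no l≢l' | l∈P , l≢x | l'∈P , l'≢x = ⊥-elim (<⇒≱ (s≤s short) (three≤len l∈P l'∈P x∈P l≢l' l≢x l'≢x))

  Inv-step : ∀ {C D x E} → Inv C → Inv D → len C ≤ 2 ⊎ len D ≤ 2 → Clash C D x → E ≐ resolvent C D x → Inv E
  Inv-step (inj₁ oC) (inj₁ oD) _ clash e = inj₁ (OverK-≐ e (overK-resolvent oC oD clash))
  Inv-step (inj₂ wC) _ (inj₁ short) = ⊥-elim (<⇒≱ (s≤s short) (Wide.long wC))
  Inv-step _ (inj₂ wD) (inj₂ short) = ⊥-elim (<⇒≱ (s≤s short) (Wide.long wD))
  Inv-step (inj₁ oC) (inj₂ wD) (inj₁ short) clash e = inj₂ (Wide-≐ e (short-wide oC short wD clash))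
  Inv-step {C} {D} {x} (inj₂ wC) (inj₁ oD) (inj₂ short) clash e =
    inj₂ (Wide-≐ (≐-trans e (resolvent-sym {C} {D} {x})) (short-wide oD short wC (clash-sym clash)))

  final-overK : ∀ {D} → D ∈ Final.axioms → OverK (ren ρFinal D)
  final-overK {D} D∈ = record
    { nonTaut = NonTaut-ren injective-final bD (All.lookup Final.axioms-nonTaut D∈)
    ; inK = Allₚ.map⁺ (All.map (λ {l} l<3 → var l , l<3 , sym (var-renL ρFinal l)) bD)
    ; sat = λ b → sat-ren (Final.ψ b) (φ b) ρFinal (φ-final b) bD (All.lookup (Final.axioms-sat b) D∈) }
    where bD : Bounded 3 D
          bD = All.lookup Final.axioms-bounded D∈

  shape-wide : ∀ {ρ K' j D} → InjectiveBelow ρ K' → Bounded K' D → NonTaut D → Shape j D →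
               (∀ {a} → a < j → ¬ InK (ρ a)) → Wide (ren ρ D)
  shape-wide {ρ} {K'} {D = a ∷ b ∷ c ∷ []} inj bD@(ba ∷ bb ∷ bc ∷ []) nt (a<j , b<j , a≢b , a≢c , b≢c) outside = record
    { nonTaut = NonTaut-ren inj bD nt
    ; long = three≤len {C = ren ρ (a ∷ b ∷ c ∷ [])} (here refl) (there (here refl)) (there (there (here refl))) ra≢rb ra≢rc rb≢rc
    ; a = renL ρ a ; b = renL ρ b ; a∈ = here refl ; b∈ = there (here refl) ; a≢b = ra≢rb
    ; a∉K = ra∉K ; b∉K = rb∉K
    ; oneK = oneK }
    where
    renamed-≢ : ∀ {l l'} → BoundedLit K' l → BoundedLit K' l' → var l ≢ var l' → renL ρ l ≢ renL ρ l'
    renamed-≢ {l} {l'} bl bl' ≢ e = ≢ (inj _ _ bl bl' (trans (sym (var-renL ρ l)) (trans (cong var e) (var-renL ρ l'))))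
    ra≢rb : renL ρ a ≢ renL ρ b
    ra≢rb = renamed-≢ ba bb a≢b
    ra≢rc : renL ρ a ≢ renL ρ c
    ra≢rc = renamed-≢ ba bc a≢c
    rb≢rc : renL ρ b ≢ renL ρ c
    rb≢rc = renamed-≢ bb bc b≢c
    ra∉K : ¬ InK (var (renL ρ a))
    ra∉K = subst (¬_ ∘ InK) (sym (var-renL ρ a)) (outside a<j)
    rb∉K : ¬ InK (var (renL ρ b))
    rb∉K = subst (¬_ ∘ InK) (sym (var-renL ρ b)) (outside b<j)
    only-c : ∀ {l} → l ∈ ren ρ (a ∷ b ∷ c ∷ []) → InK (var l) → l ≡ renL ρ c
    only-c (here refl) l∈K = ⊥-elim (ra∉K l∈K)
    only-c (there (here refl)) l∈K = ⊥-elim (rb∉K l∈K)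
    only-c (there (there (here refl))) _ = refl
    oneK : AtMostOneK (ren ρ (a ∷ b ∷ c ∷ []))
    oneK l l' l∈ l'∈ l∈K l'∈K = trans (only-c l∈ l∈K) (sym (only-c l'∈ l'∈K))

  outside-K : ∀ {a} → Rel a → All (a ≢_) finalNames → ¬ InK (nm a)
  outside-K rel-a a∉ (b , b<3 , e) =
    All.lookup a∉ (nameAt-∈ finalNames b<3) (dn _ _ rel-a (All.lookup finalNames-relevant (nameAt-∈ finalNames b<3)) (sym e))

  index-below : ∀ {k} → k < m → ∀ j → j + k ≢ j + m
  index-below k<m j e = <⇒≢ k<m (+-cancelˡ-≡ j _ _ e)

  start-outside : ∀ {a} → a < 2 → ¬ InK (ρStart a)
  start-outside {0} _ = outside-K (All.lookup startNames-relevant (here refl)) ((λ ()) ∷ (λ ()) ∷ (λ ()) ∷ [])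
  start-outside {1} _ = outside-K (All.lookup startNames-relevant (there (here refl))) ((λ ()) ∷ (λ ()) ∷ (λ ()) ∷ [])
  start-outside {suc (suc _)} (s≤s (s≤s ()))

  step-outside : ∀ {k} → k < m → ∀ {a} → a < 3 → ¬ InK (ρStep k a)
  step-outside {k} k<m {0} _ = outside-K (All.lookup (stepNames-relevant k<m) (here refl))
    ((λ e → index-below k<m 2 (cong idx e)) ∷ (λ ()) ∷ (λ ()) ∷ [])
  step-outside {k} k<m {1} _ = outside-K (All.lookup (stepNames-relevant k<m) (there (here refl)))
    ((λ ()) ∷ (λ e → index-below k<m 2 (cong idx e)) ∷ (λ ()) ∷ [])
  step-outside {k} k<m {2} _ = outside-K (All.lookup (stepNames-relevant k<m) (there (there (here refl))))
    ((λ ()) ∷ (λ ()) ∷ (λ e → index-below k<m 3 (cong idx e)) ∷ [])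
  step-outside k<m {suc (suc (suc _))} (s≤s (s≤s (s≤s ())))

  axiom-inv : ∀ {D} → Origin D → Inv D
  axiom-inv (start D∈ refl) = inj₂ (shape-wide injective-start (All.lookup Start.axioms-bounded D∈)
    (All.lookup Start.axioms-nonTaut D∈) (All.lookup Start.axioms-shape D∈) start-outside)
  axiom-inv (step k<m D∈ refl) = inj₂ (shape-wide (injective-step k<m) (All.lookup Step.axioms-bounded D∈)
    (All.lookup Step.axioms-nonTaut D∈) (All.lookup Step.axioms-shape D∈) (step-outside k<m))
  axiom-inv (final D∈ refl) = inj₁ (final-overK D∈)

  derived-inv : ∀ {C} (t : Deriv T C) → HardnessBound 2 t → Inv C
  derived-inv (axiom D∈) _ = axiom-inv (origin D∈)
  derived-inv (res x t₁ t₂ clash e) (short , h₁ , h₂) = Inv-step (derived-inv t₁ h₁) (derived-inv t₂ h₂) short clash e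

  empty-not-inv : ¬ Inv []
  empty-not-inv (inj₁ overK) with OverK.sat overK true
  ... | ()
  empty-not-inv (inj₂ wide) with Wide.long wide
  ... | ()

  no-hardness<3 : ∀ j → j < 3 → ¬ HasWhd T j
  no-hardness<3 j j<3 (t , hard) = empty-not-inv (derived-inv t (hardness-mono (≤-pred j<3) t hard))

  no-width<3 : ∀ j → j < 3 → ¬ HasWid T j
  no-width<3 j j<3 (t , wide) = no-hardness<3 j j<3 (t , width⇒hardness j t wide)

module TwoVariables (nm : VName → Var) (dn : DistinctNames 2 nm) where

  open Resolution
  open Renaming
  open Gadgets
  open Placement 2 nm dn
  open import Data.Nat using (_≤_; s≤s; z≤n; _≟_)
  open import Data.List using ([]; _∷_; map; concatMap)
  open import Data.List.Properties using (length-map)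
  open import Data.List.Relation.Unary.All as All using (All; []; _∷_)
  import Data.List.Relation.Unary.All.Properties as Allₚ
  open import Data.List.Relation.Unary.Any using (here; there)
  open import Data.List.Relation.Unary.AllPairs using ([]; _∷_)
  open import Data.List.Membership.Propositional using (_∈_)
  open import Data.List.Membership.Propositional.Properties using (∈-map⁺; ∈-map⁻)
  open import Data.Product using (_,_; proj₂)
  open import Function using (_∘_)
  open import Relation.Binary.PropositionalEquality using (_≡_; _≢_; refl; trans)
  open import Relation.Binary.PropositionalEquality.Properties using (decSetoid)

  ρ : Var → Var
  ρ = naming (V 1 ∷ V 2 ∷ [])

  injective : InjectiveBelow ρ 2
  injective = naming-injective (((λ ()) ∷ []) ∷ [] ∷ []) ((s≤s z≤n , s≤s z≤n) ∷ (s≤s z≤n , s≤s (s≤s z≤n)) ∷ [])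

  T : ClauseSet
  T = Tn 2 nm

  axiom∈T : ∀ {D} → D ∈ Two.axioms → ren ρ D ∈ T
  axiom∈T = ∈-map⁺ (ren ρ)

  module TwoT = Transport injective Two.axioms-bounded (λ D∈ → axiom (axiom∈T D∈))

  refutation : Refutation T
  refutation = TwoT.transport Two.refutation

  refutation-count : numClauses refutation ≡ 7
  refutation-count = trans (ClauseD.count-distinct-cong labels⊆ ⊆labels)
    (trans (ClauseD.count-unique (unique-ren injective Two.proofClauses-bounded Two.proofClauses-unique))
           (length-map (ren ρ) Two.proofClauses))
    where
    labels⊆ : labels refutation ⊆ᶜ map (ren ρ) Two.proofClauses
    labels⊆ = ++-⊆ᶜ (map-ren-⊆ᶜ ρ Two.proofClauses-⊆) ⊆ᶜ-refl ∘
      TwoT.labels-⊆ _ axiom⊆ Two.refutation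
      where
      axiom⊆ : ∀ {D} → D ∈ Two.axioms → ren ρ D ∷ [] ⊆ᶜ map (ren ρ) Two.proofClauses
      axiom⊆ D∈ = singleton-⊆ᶜ (map-ren-⊆ᶜ ρ Two.axioms-⊆ (∈⇒∈ᶜ (∈-map⁺ (ren ρ) D∈)))
    ⊆labels : map (ren ρ) Two.proofClauses ⊆ᶜ labels refutation
    ⊆labels = TwoT.labels-⊇ Two.refutation ∘ map-ren-⊆ᶜ ρ Two.⊆-proofClauses

  unsat : Unsatisfiable T
  unsat = Soundness.refutation⇒unsat (Allₚ.map⁺ {f = ren ρ} (nonTaut-ren injective Two.axioms-bounded Two.axioms-nonTaut)) refutation

  lengths : All (λ C → len C ≤ 3) T
  lengths = Allₚ.map⁺ {f = ren ρ} (lengths-ren {_≤ 3} injective Two.axioms-bounded (All.map proj₂ Two.axioms-lengths))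

  clauses : cF T ≡ 4
  clauses = trans (ClauseD.count-unique (unique-ren injective Two.axioms-bounded Two.axioms-unique))
                  (length-map (ren ρ) Two.axioms)

  literals : ℓF T ≡ 8
  literals = trans (ClauseD.sum-distinct-unique {len} (unique-ren injective Two.axioms-bounded Two.axioms-unique))
                   (Σlen-ren injective Two.axioms-bounded)

  variables : nF T ≡ 2
  variables = trans (VarD.count-distinct-cong vars⊆ ⊆vars) (VarD.count-unique ((v₁≢v₂ ∷ []) ∷ [] ∷ []))
    where
    module VarD = Distinct (decSetoid _≟_)
    vars⊆ : ∀ {x} → x ∈ concatMap (map var) T → x ∈ ρ 0 ∷ ρ 1 ∷ []
    vars⊆ x∈ with ∈-map⁻ ρ x∈
    ... | a , a∈ , refl with All.lookup Two.axioms-variables a∈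
    ...   | here refl = here refl
    ...   | there (here refl) = there (here refl)
    ⊆vars : ∀ {x} → x ∈ ρ 0 ∷ ρ 1 ∷ [] → x ∈ concatMap (map var) T
    ⊆vars (here refl) = here refl
    ⊆vars (there (here refl)) = there (here refl)
    v₁≢v₂ : ρ 0 ≢ ρ 1
    v₁≢v₂ e with injective 0 1 (s≤s z≤n) (s≤s (s≤s z≤n)) e
    ... | ()

open Resolution
open Renaming
open import Data.Nat using (zero; suc; s≤s; z≤n)
open import Data.List using ([]; _∷_)
open import Data.List.Relation.Unary.All using ([]; _∷_)
open import Data.List.Relation.Unary.Any using (here; there)
open import Data.Product using (_,_)
open import Relation.Binary.PropositionalEquality using (refl)

T₁-unsat : ∀ nm → Unsatisfiable (Tn 1 nm)
T₁-unsat nm = complementary-units (there (here refl)) (here refl)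

theorem10p6 : (n : ℕ) → 1 ≤ n → (nm : VName → Var) → DistinctNames n nm →
    (2 ≤ n → nF (Tn n nm) ≡ 3 * n ∸ 4) ×
    (2 ≤ n → cF (Tn n nm) ≡ 8 * n ∸ 12) ×
    (2 ≤ n → ℓF (Tn n nm) ≡ 24 * n ∸ 40) ×
    (Unsatisfiable (Tn n nm) × All (λ C → len C ≤ 3) (Tn n nm)) ×
    (3 ≤ n → WhdIs (Tn n nm) 3 × WidIs (Tn n nm) 3) ×
    (2 ≤ n → Σ (Refutation (Tn n nm)) (λ t → numClauses t ≡ 18 * n ∸ 29))
theorem10p6 zero () nm dn
theorem10p6 1 _ nm dn =
  (λ { (s≤s ()) }) , (λ { (s≤s ()) }) , (λ { (s≤s ()) }) ,
  (T₁-unsat nm , s≤s z≤n ∷ s≤s z≤n ∷ []) ,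
  (λ { (s≤s ()) }) , (λ { (s≤s ()) })
theorem10p6 2 _ nm dn =
  (λ _ → variables) , (λ _ → clauses) , (λ _ → literals) , (unsat , lengths) ,
  (λ { (s≤s (s≤s ())) }) , (λ _ → refutation , refutation-count)
  where open TwoVariables nm dn
theorem10p6 (suc (suc (suc m))) _ nm dn =
  (λ _ → T-variables) , (λ _ → T-clauses) , (λ _ → T-literals) , (T-unsat , T-lengths) ,
  (λ _ → (hardness-3 , no-hardness<3) , ((refutation , refutation-width) , no-width<3)) ,
  (λ _ → refutation , refutation-count)
  where
  open Chain m nm dn using (refutation)
  open Measures m nm dn
  open LowerBound m nm dn using (no-hardness<3; no-width<3)
  hardness-3 : HasWhd (Tn (3 + m) nm) 3
  hardness-3 = refutation , width⇒hardness 3 refutation refutation-width
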